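{- For every $n\ge 1$, the map $\Lambda_{n+2}$ is a bijection from the set $T_{n+2}$ of triangulations of the convex $(n+2)$-gon onto $\mathbb{Y}_n$.
   Context: A Young diagram is identified with a partition $D=(d_1,d_2,\dots)$, $d_1\ge d_2\ge\dots\ge 0$ integers, only finitely many nonzero. $\mathbb{Y}_n$ is the set of Young diagrams lying in the triangle bounded by the coordinate axes and the line $y=x-n$ (rows drawn in the fourth quadrant, row $k$ occupying $[0,d_k]\times[-k,-k+1]$), i.e. $d_k\le n-k$ for $1\le k\le n-1$ and $d_k=0$ for $k\ge n$. Label the vertices of a convex $(n+2)$-gon $0,1,\dots,n+1$ counterclockwise. A triangulation is a set of diagonals, pairwise either sharing an endpoint or non-intersecting, dividing the polygon into triangles (it has $n-1$ diagonals). The tail of a diagonal is its smaller endpoint. For $A\in T_{n+2}$, $\Lambda_{n+2}(A)=(\lambda_1,\dots,\lambda_{n-1},0,0,\dots)$, where $\lambda_1\ge\dots\ge\lambda_{n-1}$ are the tails of the diagonals of $A$ listed in decreasing order. -}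

module Defs where

open import Data.Nat using (ℕ; zero; suc; _+_; _∸_; _≤_; _<_)
open import Data.Bool using (Bool; true; false)
open import Data.Fin using (Fin; toℕ)
open import Data.Vec using (Vec; lookup)
import Data.Vec as Vec
import Data.List as L
open import Data.List using (List; []; _∷_)
open import Data.Product using (Σ; _×_; ∃; _,_)
open import Data.Sum using (_⊎_)
open import Relation.Binary.PropositionalEquality using (_≡_)
open import Relation.Nullary using (¬_)

-- Vertices of the convex (n+2)-gon: Fin (n + 2), labelled 0..n+1 counterclockwise.
Vertex : ℕ → Set
Vertex n = Fin (suc (suc n))

-- A set of diagonals of the (n+2)-gon, encoded as a Boolean (n+2)×(n+2) matrix:
-- entry (i , j) is true iff the diagonal {i , j} with i < j (tail i) belongs to the set.
-- (Well-formedness, i.e. only entries at genuine diagonals (i < j) are true, is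
--  part of the triangulation predicate below, so this encoding is a bijective
--  encoding of sets of diagonals.)
DiagSet : ℕ → Set
DiagSet n = Vec (Vec Bool (suc (suc n))) (suc (suc n))

_∈D_ : ∀ {n} → Vertex n × Vertex n → DiagSet n → Set
_∈D_ {n} (i , j) A = lookup (lookup A i) j ≡ true

-- {i , j} with i < j is a diagonal: not a side of the polygon, i.e.
-- j ≥ i + 2 and (i , j) ≠ (0 , n+1).
IsDiagonal : ∀ n → Vertex n → Vertex n → Set
IsDiagonal n i j = (toℕ i + 2 ≤ toℕ j) × ¬ ((toℕ i ≡ 0) × (toℕ j ≡ suc n))

-- Diagonals {i,j} (i<j) and {k,l} (k<l) of a convex polygon intersect in
-- an interior point iff their endpoints interleave strictly.
Cross : ∀ {n} → Vertex n → Vertex n → Vertex n → Vertex n → Set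
Cross i j k l =
  ((toℕ i < toℕ k) × (toℕ k < toℕ j) × (toℕ j < toℕ l))
  ⊎ ((toℕ k < toℕ i) × (toℕ i < toℕ l) × (toℕ l < toℕ j))

-- A triangulation: a set of diagonals, pairwise non-crossing (sharing an
-- endpoint is allowed), which divides the polygon into triangles; the latter
-- is rendered combinatorially as maximality: every diagonal not in the set
-- crosses some diagonal of the set.
record IsTriangulation (n : ℕ) (A : DiagSet n) : Set where
  field
    onlyDiagonals : ∀ i j → (i , j) ∈D A → IsDiagonal n i j
    nonCrossing   : ∀ i j k l → (i , j) ∈D A → (k , l) ∈D A → ¬ Cross i j k l
    maximal       : ∀ i j → IsDiagonal n i j → ¬ ((i , j) ∈D A) →
                    Σ (Vertex n) λ k → Σ (Vertex n) λ l → ((k , l) ∈D A) × Cross i j k l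

countTrue : ∀ {m} → Vec Bool m → ℕ
countTrue Vec.[] = 0
countTrue (true Vec.∷ bs) = suc (countTrue bs)
countTrue (false Vec.∷ bs) = countTrue bs

tails : ∀ {n} → DiagSet n → List ℕ
tails {n} A = L.concatMap (λ i → L.replicate (countTrue (lookup A i)) (toℕ i))
                          (L.reverse (L.allFin (suc (suc n))))

-- k-th entry (0-based) of a list, 0 beyond its end.
nth : List ℕ → ℕ → ℕ
nth [] k = 0
nth (x ∷ xs) zero = x
nth (x ∷ xs) (suc k) = nth xs k

-- A partition / Young diagram as a sequence d, with d k = d_{k+1} (0-based).
Sequence : Set
Sequence = ℕ → ℕ

-- Λ_{n+2}(A) = (λ_1, …, λ_{n-1}, 0, 0, …), tails in decreasing order.
Λ : ∀ {n} → DiagSet n → Sequence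
Λ A k = nth (tails A) k

IsYoungDiagram : Sequence → Set
IsYoungDiagram d = (∀ k → d (suc k) ≤ d k) × ∃ λ N → ∀ k → N ≤ k → d k ≡ 0

-- 𝕐_n: d_k ≤ n - k for 1 ≤ k ≤ n-1 and d_k = 0 for k ≥ n  (here k ↦ k+1).
InY : ℕ → Sequence → Set
InY n d = IsYoungDiagram d
        × (∀ k → suc k ≤ n ∸ 1 → d k ≤ n ∸ suc k)
        × (∀ k → n ≤ suc k → d k ≡ 0)

module Submission where

open import Defs
open import Data.Nat using (ℕ; zero; suc; _+_; _∸_; _≤_; _<_; _≥_; z≤n; s≤s; _≟_; _≤?_; _<?_; _≡ᵇ_; _<ᵇ_)
open import Data.Nat.Properties
open import Data.Bool using (Bool; true; false; if_then_else_; T)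
open import Data.Unit using (tt)
open import Data.Fin using (Fin; toℕ; fromℕ<) renaming (zero to fzero; suc to fsuc)
open import Data.Fin.Properties using (toℕ<n; toℕ-fromℕ<)
open import Data.Vec as Vec using (Vec; lookup; tabulate)
open import Data.List as List using (List; []; _∷_; _++_; map; replicate; reverse; concatMap; length; take; drop)
open import Data.List.Properties using (length-++; length-map; length-replicate; length-take; take-[]; map-tabulate;
  unfold-reverse; concatMap-++; ++-identityʳ; reverse-map; concatMap-map; concatMap-cong; map-replicate; map-concatMap)
open import Data.List.Relation.Unary.All as All using (All; []; _∷_)
open import Data.List.Relation.Unary.AllPairs as AllPairs using (AllPairs; []; _∷_)
open import Data.List.Relation.Unary.AllPairs.Properties using (take⁺; drop⁺)
open import Data.List.Relation.Unary.Linked as Linked using (Linked; []; [-]; _∷_)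
open import Data.List.Relation.Unary.Any using (here; there; any?)
open import Data.List.Membership.DecPropositional _≟_ using (_∈_; _∉_; _∈?_; find; lose)
open import Data.Product using (Σ; _×_; _,_; proj₁; proj₂; ∃)
open import Data.Sum using (_⊎_; inj₁; inj₂)
open import Data.Empty using (⊥-elim)
open import Function using (_∘_; id)
open import Relation.Nullary using (¬_; Dec; yes; no; does)
open import Relation.Nullary.Decidable using (_×-dec_; dec-true)
open import Relation.Binary.PropositionalEquality

-- Encode a set of diagonals by its rows: row t lists the heads of the diagonals
-- with tail t.  Then Λ A is  blocks N c , the decreasing list containing each t
-- exactly c t = |row t| times, so Λ A records precisely the row sizes c t, t ≥ 1.
-- For given sizes c, the vertices "visible" from t are computed from the right:
-- t sees t + 1 and whatever t + 1 sees that is not hidden by its c (t + 1)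
-- diagonals, which go to the first c (t + 1) vertices it sees beyond t + 2.  Row 0
-- takes all it sees except 1 and n + 1.  The file proves, in this order:
--  * list lemmas: decreasing lists and their multiplicities, increasing lists;
--  * visibility: visible = unobstructed, and a length count showing that the rows
--    fit iff the counting condition (≤ n - s diagonals with tail in [s, n]) holds;
--  * rigidity: every triangulation is the canonical one for its row sizes, which
--    therefore fit; conversely the canonical rows always form a triangulation;
--  * the dictionary between Boolean matrices and rows, and between sizes
--    satisfying the counting condition and diagrams in 𝕐_n.

Decreasing : List ℕ → Set
Decreasing = Linked _≥_

sumFrom : (ℕ → ℕ) → ℕ → ℕ → ℕ
sumFrom h a zero = 0
sumFrom h a (suc b) = h a + sumFrom h (suc a) b

sumFrom-shift : ∀ h a b → sumFrom (h ∘ suc) a b ≡ sumFrom h (suc a) b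
sumFrom-shift h a zero = refl
sumFrom-shift h a (suc b) = cong (h (suc a) +_) (sumFrom-shift h (suc a) b)

sumFrom-split : ∀ h a b e → sumFrom h a (b + e) ≡ sumFrom h a b + sumFrom h (a + b) e
sumFrom-split h a zero e = cong (λ x → sumFrom h x e) (sym (+-identityʳ a))
sumFrom-split h a (suc b) e = begin
    h a + sumFrom h (suc a) (b + e)
  ≡⟨ cong (h a +_) (sumFrom-split h (suc a) b e) ⟩
    h a + (sumFrom h (suc a) b + sumFrom h (suc a + b) e)
  ≡⟨ sym (+-assoc (h a) _ _) ⟩
    h a + sumFrom h (suc a) b + sumFrom h (suc a + b) e
  ≡⟨ cong (λ x → h a + sumFrom h (suc a) b + sumFrom h x e) (sym (+-suc a b)) ⟩
    h a + sumFrom h (suc a) b + sumFrom h (a + suc b) e ∎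
  where open ≡-Reasoning

sumFrom-vanishing : ∀ h a b → (∀ x → a ≤ x → h x ≡ 0) → sumFrom h a b ≡ 0
sumFrom-vanishing h a zero vanish = refl
sumFrom-vanishing h a (suc b) vanish =
  cong₂ _+_ (vanish a ≤-refl) (sumFrom-vanishing h (suc a) b (λ x a<x → vanish x (<⇒≤ a<x)))

-- The decreasing list in which every t < m occurs exactly h t times; the
-- list of tails of a set of diagonals is of this form (h = row counts).
blocks : ℕ → (ℕ → ℕ) → List ℕ
blocks zero h = []
blocks (suc m) h = map suc (blocks m (h ∘ suc)) ++ replicate (h 0) 0

-- blocks m h depends only on the values of h (there is no function extensionality).
blocks-cong : ∀ m {h h′} → (∀ t → h t ≡ h′ t) → blocks m h ≡ blocks m h′
blocks-cong zero eq = refl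
blocks-cong (suc m) eq = cong₂ (λ xs a → map suc xs ++ replicate a 0) (blocks-cong m (eq ∘ suc)) (eq 0)

zeros-decreasing : ∀ a → Decreasing (replicate a 0)
zeros-decreasing zero = []
zeros-decreasing (suc zero) = [-]
zeros-decreasing (suc (suc a)) = z≤n ∷ zeros-decreasing (suc a)

shift-decreasing : ∀ xs a → Decreasing xs → Decreasing (map suc xs ++ replicate a 0)
shift-decreasing [] a _ = zeros-decreasing a
shift-decreasing (x ∷ []) zero _ = [-]
shift-decreasing (x ∷ []) (suc a) _ = z≤n ∷ zeros-decreasing (suc a)
shift-decreasing (x ∷ y ∷ ys) a (y≤x ∷ dec) = s≤s y≤x ∷ shift-decreasing (y ∷ ys) a dec

blocks-decreasing : ∀ m h → Decreasing (blocks m h)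
blocks-decreasing zero h = []
blocks-decreasing (suc m) h = shift-decreasing _ (h 0) (blocks-decreasing m (h ∘ suc))

multiplicity : ℕ → List ℕ → ℕ
multiplicity t [] = 0
multiplicity t (x ∷ xs) = if x ≡ᵇ t then suc (multiplicity t xs) else multiplicity t xs

countAtLeast : ℕ → List ℕ → ℕ
countAtLeast s [] = 0
countAtLeast s (x ∷ xs) = if x <ᵇ s then countAtLeast s xs else suc (countAtLeast s xs)

<ᵇ-true : ∀ x s → (x <ᵇ s) ≡ true → x < s
<ᵇ-true x s eq = <ᵇ⇒< x s (subst T (sym eq) tt)

<ᵇ-false : ∀ x s → (x <ᵇ s) ≡ false → s ≤ x
<ᵇ-false x s eq = ≮⇒≥ (λ x<s → subst T eq (<⇒<ᵇ x<s))

multiplicity-++ : ∀ t xs ys → multiplicity t (xs ++ ys) ≡ multiplicity t xs + multiplicity t ys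
multiplicity-++ t [] ys = refl
multiplicity-++ t (x ∷ xs) ys with x ≡ᵇ t
... | true = cong suc (multiplicity-++ t xs ys)
... | false = multiplicity-++ t xs ys

multiplicity-shift : ∀ t xs → multiplicity (suc t) (map suc xs) ≡ multiplicity t xs
multiplicity-shift t [] = refl
multiplicity-shift t (x ∷ xs) with x ≡ᵇ t
... | true = cong suc (multiplicity-shift t xs)
... | false = multiplicity-shift t xs

multiplicity-shift-zero : ∀ xs → multiplicity 0 (map suc xs) ≡ 0
multiplicity-shift-zero [] = refl
multiplicity-shift-zero (x ∷ xs) = multiplicity-shift-zero xs

multiplicity-zeros : ∀ t a → multiplicity t (replicate a 0) ≡ (if 0 ≡ᵇ t then a else 0)
multiplicity-zeros zero zero = refl
multiplicity-zeros zero (suc a) = cong suc (multiplicity-zeros zero a)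
multiplicity-zeros (suc t) zero = refl
multiplicity-zeros (suc t) (suc a) = multiplicity-zeros (suc t) a

multiplicity-shifted-suc : ∀ t xs a → multiplicity (suc t) (map suc xs ++ replicate a 0) ≡ multiplicity t xs
multiplicity-shifted-suc t xs a = begin
    multiplicity (suc t) (map suc xs ++ replicate a 0)
  ≡⟨ multiplicity-++ (suc t) (map suc xs) (replicate a 0) ⟩
    multiplicity (suc t) (map suc xs) + multiplicity (suc t) (replicate a 0)
  ≡⟨ cong₂ _+_ (multiplicity-shift t xs) (multiplicity-zeros (suc t) a) ⟩
    multiplicity t xs + 0
  ≡⟨ +-identityʳ _ ⟩
    multiplicity t xs ∎
  where open ≡-Reasoning

multiplicity-shifted-zero : ∀ xs a → multiplicity 0 (map suc xs ++ replicate a 0) ≡ a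
multiplicity-shifted-zero xs a =
  trans (multiplicity-++ 0 (map suc xs) (replicate a 0))
        (cong₂ _+_ (multiplicity-shift-zero xs) (multiplicity-zeros 0 a))

multiplicity-blocks : ∀ m h t → t < m → multiplicity t (blocks m h) ≡ h t
multiplicity-blocks (suc m) h zero _ = multiplicity-shifted-zero (blocks m (h ∘ suc)) (h 0)
multiplicity-blocks (suc m) h (suc t) (s≤s t<m) =
  trans (multiplicity-shifted-suc t (blocks m (h ∘ suc)) (h 0)) (multiplicity-blocks m (h ∘ suc) t t<m)

countAtLeast-++ : ∀ s xs ys → countAtLeast s (xs ++ ys) ≡ countAtLeast s xs + countAtLeast s ys
countAtLeast-++ s [] ys = refl
countAtLeast-++ s (x ∷ xs) ys with x <ᵇ s
... | true = countAtLeast-++ s xs ys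
... | false = cong suc (countAtLeast-++ s xs ys)

countAtLeast-shift : ∀ s xs → countAtLeast (suc s) (map suc xs) ≡ countAtLeast s xs
countAtLeast-shift s [] = refl
countAtLeast-shift s (x ∷ xs) with x <ᵇ s
... | true = countAtLeast-shift s xs
... | false = cong suc (countAtLeast-shift s xs)

countAtLeast-zeros : ∀ s a → countAtLeast (suc s) (replicate a 0) ≡ 0
countAtLeast-zeros s zero = refl
countAtLeast-zeros s (suc a) = countAtLeast-zeros s a

countAtLeast-zero : ∀ xs → countAtLeast 0 xs ≡ length xs
countAtLeast-zero [] = refl
countAtLeast-zero (x ∷ xs) = cong suc (countAtLeast-zero xs)

countAtLeast-blocks : ∀ m h s → countAtLeast s (blocks m h) ≡ sumFrom h s (m ∸ s)
countAtLeast-blocks zero h zero = refl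
countAtLeast-blocks zero h (suc s) = refl
countAtLeast-blocks (suc m) h zero = begin
    countAtLeast 0 (map suc xs ++ replicate (h 0) 0)
  ≡⟨ countAtLeast-zero (map suc xs ++ replicate (h 0) 0) ⟩
    length (map suc xs ++ replicate (h 0) 0)
  ≡⟨ length-++ (map suc xs) ⟩
    length (map suc xs) + length (replicate (h 0) 0)
  ≡⟨ cong₂ _+_ (trans (length-map suc xs) (sym (countAtLeast-zero xs))) (length-replicate (h 0)) ⟩
    countAtLeast 0 xs + h 0
  ≡⟨ +-comm _ (h 0) ⟩
    h 0 + countAtLeast 0 xs
  ≡⟨ cong (h 0 +_) (trans (countAtLeast-blocks m (h ∘ suc) 0) (sumFrom-shift h 0 m)) ⟩
    sumFrom h 0 (suc m) ∎
  where
  open ≡-Reasoning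
  xs : List ℕ
  xs = blocks m (h ∘ suc)
countAtLeast-blocks (suc m) h (suc s) = begin
    countAtLeast (suc s) (map suc xs ++ replicate (h 0) 0)
  ≡⟨ countAtLeast-++ (suc s) (map suc xs) _ ⟩
    countAtLeast (suc s) (map suc xs) + countAtLeast (suc s) (replicate (h 0) 0)
  ≡⟨ cong₂ _+_ (countAtLeast-shift s xs) (countAtLeast-zeros s (h 0)) ⟩
    countAtLeast s xs + 0
  ≡⟨ +-identityʳ _ ⟩
    countAtLeast s xs
  ≡⟨ trans (countAtLeast-blocks m (h ∘ suc) s) (sumFrom-shift h s (m ∸ s)) ⟩
    sumFrom h (suc s) (m ∸ s) ∎
  where
  open ≡-Reasoning
  xs : List ℕ
  xs = blocks m (h ∘ suc)

nth-beyond : ∀ xs k → length xs ≤ k → nth xs k ≡ 0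
nth-beyond [] k _ = refl
nth-beyond (x ∷ xs) (suc k) (s≤s le) = nth-beyond xs k le

decreasing-nth : ∀ {xs} → Decreasing xs → ∀ k → nth xs (suc k) ≤ nth xs k
decreasing-nth [] k = z≤n
decreasing-nth [-] k = z≤n
decreasing-nth (y≤x ∷ dec) zero = y≤x
decreasing-nth (y≤x ∷ dec) (suc k) = decreasing-nth dec k

decreasing-head : ∀ {x xs} → Decreasing (x ∷ xs) → ∀ k → nth xs k ≤ x
decreasing-head [-] k = z≤n
decreasing-head (y≤x ∷ dec) zero = y≤x
decreasing-head (y≤x ∷ dec) (suc k) = ≤-trans (decreasing-head dec k) y≤x

countAtLeast-above-nth : ∀ {xs} → Decreasing xs → ∀ s k → 1 ≤ s → s ≤ nth xs k → suc k ≤ countAtLeast s xs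
countAtLeast-above-nth {[]} _ s k 1≤s s≤0 = ⊥-elim (n≮0 (≤-trans 1≤s s≤0))
countAtLeast-above-nth {x ∷ xs} dec s k 1≤s s≤xk with x <ᵇ s in eq
... | true = ⊥-elim (<⇒≱ (<ᵇ-true x s eq) (≤-trans s≤xk (nth≤head k)))
  where
  nth≤head : ∀ k → nth (x ∷ xs) k ≤ x
  nth≤head zero = ≤-refl
  nth≤head (suc k) = decreasing-head dec k
countAtLeast-above-nth {x ∷ xs} dec s zero 1≤s s≤xk | false = s≤s z≤n
countAtLeast-above-nth {x ∷ xs} dec s (suc k) 1≤s s≤xk | false =
  s≤s (countAtLeast-above-nth (Linked.tail dec) s k 1≤s s≤xk)

countAtLeast-below-head : ∀ {x xs} → Decreasing (x ∷ xs) → ∀ s → x < s → countAtLeast s (x ∷ xs) ≡ 0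
countAtLeast-below-head {x} dec s x<s with x <ᵇ s in eq
... | false = ⊥-elim (<⇒≱ x<s (<ᵇ-false x s eq))
countAtLeast-below-head {x} [-] s x<s | true = refl
countAtLeast-below-head {x} (y≤x ∷ dec) s x<s | true = countAtLeast-below-head dec s (≤-<-trans y≤x x<s)

countAtLeast-tail-below : ∀ {x xs} → Decreasing (x ∷ xs) → ∀ s → x < s → countAtLeast s xs ≡ 0
countAtLeast-tail-below [-] s x<s = refl
countAtLeast-tail-below (y≤x ∷ dec) s x<s = countAtLeast-below-head dec s (≤-<-trans y≤x x<s)

nth-above-countAtLeast : ∀ {xs} → Decreasing xs → ∀ s k → suc k ≤ countAtLeast s xs → s ≤ nth xs k
nth-above-countAtLeast {x ∷ xs} dec s k k<count with x <ᵇ s in eq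
... | true = ⊥-elim (n≮0 (subst (k <_) (countAtLeast-tail-below dec s (<ᵇ-true x s eq)) k<count))
... | false with k | k<count
...   | zero | _ = <ᵇ-false x s eq
...   | suc k′ | s≤s k′<count = nth-above-countAtLeast (Linked.tail dec) s k′ k′<count

≡ᵇ-true : ∀ x t → (x ≡ᵇ t) ≡ true → x ≡ t
≡ᵇ-true x t eq = ≡ᵇ⇒≡ x t (subst T (sym eq) tt)

multiplicity-absent : ∀ {b} t xs → All (_< b) xs → b ≤ t → multiplicity t xs ≡ 0
multiplicity-absent t [] [] b≤t = refl
multiplicity-absent t (x ∷ xs) (x<b ∷ bounded) b≤t with x ≡ᵇ t in eq
... | true = ⊥-elim (<-irrefl (≡ᵇ-true x t eq) (<-≤-trans x<b b≤t))
... | false = multiplicity-absent t xs bounded b≤t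

-- The sequence k ↦ nth xs k forgets trailing zeros, but it determines the
-- multiplicities of all positive values.
multiplicity-of-null : ∀ t xs → (∀ k → nth xs k ≡ 0) → multiplicity (suc t) xs ≡ 0
multiplicity-of-null t [] null = refl
multiplicity-of-null t (x ∷ xs) null with null 0
... | refl = multiplicity-of-null t xs (null ∘ suc)

multiplicity-determined : ∀ t xs ys → (∀ k → nth xs k ≡ nth ys k) →
                          multiplicity (suc t) xs ≡ multiplicity (suc t) ys
multiplicity-determined t [] ys same = sym (multiplicity-of-null t ys (λ k → sym (same k)))
multiplicity-determined t (x ∷ xs) [] same = multiplicity-of-null t (x ∷ xs) same
multiplicity-determined t (x ∷ xs) (y ∷ ys) same with same 0
... | refl with x ≡ᵇ suc t
...   | true = cong suc (multiplicity-determined t xs ys (same ∘ suc))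
...   | false = multiplicity-determined t xs ys (same ∘ suc)

nth-padded : ∀ xs a k → nth (xs ++ replicate a 0) k ≡ nth xs k
nth-padded [] zero k = refl
nth-padded [] (suc a) zero = refl
nth-padded [] (suc a) (suc k) = nth-padded [] a k
nth-padded (x ∷ xs) a zero = refl
nth-padded (x ∷ xs) a (suc k) = nth-padded xs a k

nth-blocks-positive : ∀ m h h′ → (∀ t → h (suc t) ≡ h′ (suc t)) →
                      ∀ k → nth (blocks (suc m) h) k ≡ nth (blocks (suc m) h′) k
nth-blocks-positive m h h′ same k = begin
    nth (map suc (blocks m (h ∘ suc)) ++ replicate (h 0) 0) k
  ≡⟨ nth-padded (map suc (blocks m (h ∘ suc))) (h 0) k ⟩
    nth (map suc (blocks m (h ∘ suc))) k
  ≡⟨ cong (λ xs → nth (map suc xs) k) (blocks-cong m same) ⟩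
    nth (map suc (blocks m (h′ ∘ suc))) k
  ≡⟨ sym (nth-padded (map suc (blocks m (h′ ∘ suc))) (h′ 0) k) ⟩
    nth (map suc (blocks m (h′ ∘ suc)) ++ replicate (h′ 0) 0) k ∎
  where open ≡-Reasoning

unshift : List ℕ → List ℕ
unshift [] = []
unshift (zero ∷ xs) = []
unshift (suc x ∷ xs) = x ∷ unshift xs

zeros-shape : ∀ xs → Decreasing (0 ∷ xs) → 0 ∷ xs ≡ replicate (multiplicity 0 (0 ∷ xs)) 0
zeros-shape [] _ = refl
zeros-shape (.0 ∷ xs) (z≤n ∷ dec) = cong (0 ∷_) (zeros-shape xs dec)

unshift-shape : ∀ xs → Decreasing xs → xs ≡ map suc (unshift xs) ++ replicate (multiplicity 0 xs) 0
unshift-shape [] _ = refl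
unshift-shape (zero ∷ xs) dec = zeros-shape xs dec
unshift-shape (suc x ∷ xs) dec = cong (suc x ∷_) (unshift-shape xs (Linked.tail dec))

unshift-decreasing : ∀ xs → Decreasing xs → Decreasing (unshift xs)
unshift-decreasing [] _ = []
unshift-decreasing (zero ∷ xs) _ = []
unshift-decreasing (suc x ∷ []) _ = [-]
unshift-decreasing (suc x ∷ zero ∷ ys) _ = [-]
unshift-decreasing (suc x ∷ suc y ∷ ys) (s≤s y≤x ∷ dec) = y≤x ∷ unshift-decreasing (suc y ∷ ys) dec

unshift-bounded : ∀ m xs → All (_< suc m) xs → All (_< m) (unshift xs)
unshift-bounded m [] _ = []
unshift-bounded m (zero ∷ xs) _ = []
unshift-bounded m (suc x ∷ xs) (s≤s x<m ∷ bounded) = x<m ∷ unshift-bounded m xs bounded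

multiplicity-unshift : ∀ t xs → Decreasing xs → multiplicity (suc t) xs ≡ multiplicity t (unshift xs)
multiplicity-unshift t xs dec =
  trans (cong (multiplicity (suc t)) (unshift-shape xs dec))
        (multiplicity-shifted-suc t (unshift xs) (multiplicity 0 xs))

decreasing-as-blocks : ∀ m xs → Decreasing xs → All (_< m) xs →
                       xs ≡ blocks m (λ t → multiplicity t xs)
decreasing-as-blocks zero [] _ _ = refl
decreasing-as-blocks zero (x ∷ xs) _ (() ∷ _)
decreasing-as-blocks (suc m) xs dec bounded = begin
    xs
  ≡⟨ unshift-shape xs dec ⟩
    map suc (unshift xs) ++ replicate (multiplicity 0 xs) 0
  ≡⟨ cong (λ ys → map suc ys ++ replicate (multiplicity 0 xs) 0)
          (decreasing-as-blocks m (unshift xs) (unshift-decreasing xs dec) (unshift-bounded m xs bounded)) ⟩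
    map suc (blocks m (λ t → multiplicity t (unshift xs))) ++ replicate (multiplicity 0 xs) 0
  ≡⟨ cong (λ ys → map suc ys ++ replicate (multiplicity 0 xs) 0)
          (blocks-cong m (λ t → sym (multiplicity-unshift t xs dec))) ⟩
    blocks (suc m) (λ t → multiplicity t xs) ∎
  where open ≡-Reasoning

Increasing : List ℕ → Set
Increasing = AllPairs _<_

increasing-head : ∀ {x xs y} → Increasing (x ∷ xs) → y ∈ xs → x < y
increasing-head (x<xs ∷ _) y∈xs = All.lookup x<xs y∈xs

increasing-head≤ : ∀ {x xs y} → Increasing (x ∷ xs) → y ∈ x ∷ xs → x ≤ y
increasing-head≤ inc (here refl) = ≤-refl
increasing-head≤ inc (there y∈xs) = <⇒≤ (increasing-head inc y∈xs)

increasing-head∉ : ∀ {x xs} → Increasing (x ∷ xs) → x ∉ xs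
increasing-head∉ inc x∈xs = <-irrefl refl (increasing-head inc x∈xs)

∈-take⁻ : ∀ k {y} {xs : List ℕ} → y ∈ take k xs → y ∈ xs
∈-take⁻ (suc k) {xs = x ∷ xs} (here eq) = here eq
∈-take⁻ (suc k) {xs = x ∷ xs} (there y∈) = there (∈-take⁻ k y∈)

∈-drop1⁻ : ∀ {y} {xs : List ℕ} → y ∈ drop 1 xs → y ∈ xs
∈-drop1⁻ {xs = x ∷ xs} y∈ = there y∈

same-members : ∀ {xs ys} → Increasing xs → Increasing ys →
               (∀ {v} → v ∈ xs → v ∈ ys) → (∀ {v} → v ∈ ys → v ∈ xs) → xs ≡ ys
same-members {[]} {[]} _ _ _ _ = refl
same-members {[]} {y ∷ ys} _ _ _ ys⊆xs with ys⊆xs (here refl)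
... | ()
same-members {x ∷ xs} {[]} _ _ xs⊆ys _ with xs⊆ys (here refl)
... | ()
same-members {x ∷ xs} {y ∷ ys} incX incY xs⊆ys ys⊆xs with xs⊆ys (here refl) | ys⊆xs (here refl)
... | here refl | _ = cong (x ∷_) (same-members (AllPairs.tail incX) (AllPairs.tail incY) xs⊆ys′ ys⊆xs′)
  where
  xs⊆ys′ : ∀ {v} → v ∈ xs → v ∈ ys
  xs⊆ys′ v∈ with xs⊆ys (there v∈)
  ... | here refl = ⊥-elim (increasing-head∉ incX v∈)
  ... | there v∈ys = v∈ys
  ys⊆xs′ : ∀ {v} → v ∈ ys → v ∈ xs
  ys⊆xs′ v∈ with ys⊆xs (there v∈)
  ... | here refl = ⊥-elim (increasing-head∉ incY v∈)
  ... | there v∈xs = v∈xs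
... | there x∈ys | here refl = ⊥-elim (increasing-head∉ incY x∈ys)
... | there x∈ys | there y∈xs = ⊥-elim (<-asym (increasing-head incY x∈ys) (increasing-head incX y∈xs))

dropKeepingLast : ℕ → List ℕ → List ℕ
dropKeepingLast c [] = []
dropKeepingLast c (x ∷ []) = x ∷ []
dropKeepingLast zero (x ∷ y ∷ ys) = x ∷ y ∷ ys
dropKeepingLast (suc c) (x ∷ y ∷ ys) = dropKeepingLast c (y ∷ ys)

dropKeepingLast⊆ : ∀ c {xs v} → v ∈ dropKeepingLast c xs → v ∈ xs
dropKeepingLast⊆ c {x ∷ []} v∈ = v∈
dropKeepingLast⊆ zero {x ∷ y ∷ ys} v∈ = v∈
dropKeepingLast⊆ (suc c) {x ∷ y ∷ ys} v∈ = there (dropKeepingLast⊆ c v∈)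

dropKeepingLast-increasing : ∀ c {xs} → Increasing xs → Increasing (dropKeepingLast c xs)
dropKeepingLast-increasing c {[]} inc = inc
dropKeepingLast-increasing c {x ∷ []} inc = inc
dropKeepingLast-increasing zero {x ∷ y ∷ ys} inc = inc
dropKeepingLast-increasing (suc c) {x ∷ y ∷ ys} (_ ∷ inc) = dropKeepingLast-increasing c inc

length-dropKeepingLast : ∀ c xs → c < length xs → length (dropKeepingLast c xs) ≡ length xs ∸ c
length-dropKeepingLast c (x ∷ []) (s≤s z≤n) = refl
length-dropKeepingLast zero (x ∷ y ∷ ys) _ = refl
length-dropKeepingLast (suc c) (x ∷ y ∷ ys) (s≤s c<len) = length-dropKeepingLast c (y ∷ ys) c<len

dropKeepingLast-above : ∀ c {xs v l} → Increasing xs → v ∈ dropKeepingLast c xs →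
                        l ∈ take c (drop 1 xs) → l ≤ v
dropKeepingLast-above (suc c) {x ∷ y ∷ ys} (_ ∷ inc) v∈ (here refl) =
  increasing-head≤ inc (dropKeepingLast⊆ c v∈)
dropKeepingLast-above (suc c) {x ∷ y ∷ ys} (_ ∷ inc) v∈ (there l∈) = dropKeepingLast-above c inc v∈ l∈

∈-dropKeepingLast : ∀ c {xs v} → Increasing xs → v ∈ xs →
                    (∀ {l} → l ∈ take c (drop 1 xs) → l ≤ v) → v ∈ dropKeepingLast c xs
∈-dropKeepingLast c {x ∷ []} _ v∈ _ = v∈
∈-dropKeepingLast zero {x ∷ y ∷ ys} _ v∈ _ = v∈
∈-dropKeepingLast (suc c) {x ∷ y ∷ ys} ((x<y ∷ _) ∷ _) (here refl) above = ⊥-elim (<⇒≱ x<y (above (here refl)))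
∈-dropKeepingLast (suc c) {x ∷ y ∷ ys} (_ ∷ inc) (there v∈) above = ∈-dropKeepingLast c inc v∈ (above ∘ there)

∉-dropKeepingLast : ∀ c {xs v} → Increasing xs → v ∈ xs → v ∉ dropKeepingLast c xs →
                    ∃ λ l → l ∈ take c (drop 1 xs) × v < l
∉-dropKeepingLast c {x ∷ []} _ v∈ v∉ = ⊥-elim (v∉ v∈)
∉-dropKeepingLast zero {x ∷ y ∷ ys} _ v∈ v∉ = ⊥-elim (v∉ v∈)
∉-dropKeepingLast (suc c) {x ∷ y ∷ ys} ((x<y ∷ _) ∷ _) (here refl) v∉ = y , here refl , x<y
∉-dropKeepingLast (suc c) {x ∷ y ∷ ys} (_ ∷ inc) (there v∈) v∉ with ∉-dropKeepingLast c inc v∈ v∉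
... | l , l∈ , v<l = l , there l∈ , v<l

dropKeepingLast-below : ∀ c {xs j} → Increasing xs → j ∈ drop 1 xs → j ∉ take c (drop 1 xs) →
                        ∃ λ u → u ∈ dropKeepingLast c xs × u < j
dropKeepingLast-below zero {x ∷ y ∷ ys} inc j∈ _ = x , here refl , increasing-head inc j∈
dropKeepingLast-below (suc c) {x ∷ y ∷ ys} _ (here refl) j∉ = ⊥-elim (j∉ (here refl))
dropKeepingLast-below (suc c) {x ∷ y ∷ ys} (_ ∷ inc) (there j∈) j∉ =
  dropKeepingLast-below c inc j∈ (λ j∈′ → j∉ (there j∈′))

take-downward-closed : ∀ c {ws u l} → Increasing ws → u ∈ ws → l ∈ take c ws → u < l → u ∈ take c ws
take-downward-closed (suc c) {w ∷ ws} _ (here refl) _ _ = here refl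
take-downward-closed (suc c) {w ∷ ws} inc (there u∈) (here refl) u<l = ⊥-elim (<-asym u<l (increasing-head inc u∈))
take-downward-closed (suc c) {w ∷ ws} (_ ∷ inc) (there u∈) (there l∈) u<l = there (take-downward-closed c inc u∈ l∈ u<l)

initial-segment : ∀ {xs ws} → Increasing xs → Increasing ws → (∀ {j} → j ∈ xs → j ∈ ws) →
                  (∀ {j w} → j ∈ xs → w ∈ ws → w < j → w ∈ xs) → xs ≡ take (length xs) ws
initial-segment {[]} _ _ _ _ = refl
initial-segment {x ∷ xs} {[]} _ _ sub _ with sub (here refl)
... | ()
initial-segment {x ∷ xs} {w ∷ ws} incX incW sub closed with sub (here refl)
... | here refl = cong (x ∷_) (initial-segment (AllPairs.tail incX) (AllPairs.tail incW) sub′ closed′)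
  where
  sub′ : ∀ {j} → j ∈ xs → j ∈ ws
  sub′ j∈ with sub (there j∈)
  ... | here refl = ⊥-elim (increasing-head∉ incX j∈)
  ... | there j∈ws = j∈ws
  closed′ : ∀ {j v} → j ∈ xs → v ∈ ws → v < j → v ∈ xs
  closed′ j∈ v∈ v<j with closed (there j∈) (there v∈) v<j
  ... | here refl = ⊥-elim (increasing-head∉ incW v∈)
  ... | there v∈xs = v∈xs
... | there x∈ws with closed (here refl) (here refl) (increasing-head incW x∈ws)
...   | here w≡x = ⊥-elim (<-irrefl w≡x (increasing-head incW x∈ws))
...   | there w∈xs = ⊥-elim (<-asym (increasing-head incW x∈ws) (increasing-head incX w∈xs))

allButLast : List ℕ → List ℕ
allButLast xs = take (length xs ∸ 1) xs

∈-allButLast : ∀ {xs u y} → Increasing xs → u ∈ xs → y ∈ xs → u < y → u ∈ allButLast xs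
∈-allButLast {x ∷ []} _ (here refl) (here refl) u<y = ⊥-elim (<-irrefl refl u<y)
∈-allButLast {x ∷ x′ ∷ xs} _ (here refl) _ _ = here refl
∈-allButLast {x ∷ x′ ∷ xs} inc (there u∈) (here refl) u<y = ⊥-elim (<-asym u<y (increasing-head inc u∈))
∈-allButLast {x ∷ x′ ∷ xs} (_ ∷ inc) (there u∈) (there y∈) u<y = there (∈-allButLast inc u∈ y∈ u<y)

allButLast-below : ∀ {xs v} → Increasing xs → v ∈ allButLast xs → ∃ λ y → y ∈ xs × v < y
allButLast-below {x ∷ x′ ∷ xs} inc (here refl) = x′ , there (here refl) , increasing-head inc (here refl)
allButLast-below {x ∷ x′ ∷ xs} (_ ∷ inc) (there v∈) with allButLast-below inc v∈
... | y , y∈ , v<y = y , there y∈ , v<y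

gap-step : ∀ {t g n} → t + suc g ≡ n → suc t + g ≡ n
gap-step {t} {g} eq = trans (sym (+-suc t g)) eq

gap-size : ∀ {t g n} → t + g ≡ n → n ∸ t ≡ g
gap-size {t} {g} refl = m+n∸m≡n t g

-- The counting condition on the numbers c t of diagonals with tail t: for every
-- s = t + 1 ≥ 1, at most g = n - s diagonals have their tail in [s, n].
CountsBounded : ℕ → (ℕ → ℕ) → Set
CountsBounded n c = ∀ g t → suc t + g ≡ n → sumFrom c (suc t) (suc g) ≤ g

module Visibility (n : ℕ) (c : ℕ → ℕ) where

  -- visible t g  (where t + g = n) lists, increasingly, the vertices v > t that
  -- are seen from t when every vertex k > t sends its c k diagonals to the first
  -- c k vertices it sees beyond its neighbour k + 1: vertex t sees t + 1, and
  -- those vertices seen from t + 1 that are not hidden behind a diagonal of t + 1.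
  visible : ℕ → ℕ → List ℕ
  visible t zero = suc t ∷ []
  visible t (suc g) = suc t ∷ dropKeepingLast (c (suc t)) (visible (suc t) g)

  visible-range : ∀ g t {v} → v ∈ visible t g → suc t ≤ v × v ≤ suc (t + g)
  visible-range zero t (here refl) = ≤-refl , s≤s (≤-reflexive (sym (+-identityʳ t)))
  visible-range (suc g) t (here refl) = ≤-refl , s≤s (m≤m+n t (suc g))
  visible-range (suc g) t (there v∈) with visible-range g (suc t) (dropKeepingLast⊆ (c (suc t)) v∈)
  ... | t<v , v≤ = <⇒≤ t<v , ≤-trans v≤ (≤-reflexive (cong suc (sym (+-suc t g))))

  visible-increasing : ∀ g t → Increasing (visible t g)
  visible-increasing zero t = [] ∷ []
  visible-increasing (suc g) t =
    All.tabulate (λ v∈ → proj₁ (visible-range g (suc t) (dropKeepingLast⊆ (c (suc t)) v∈)))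
    ∷ dropKeepingLast-increasing (c (suc t)) (visible-increasing g (suc t))

  visible-tail-increasing : ∀ g t → Increasing (drop 1 (visible t g))
  visible-tail-increasing g t = drop⁺ 1 (visible-increasing g t)

  visible-unfold : ∀ g t → visible t g ≡ suc t ∷ drop 1 (visible t g)
  visible-unfold zero t = refl
  visible-unfold (suc g) t = refl

  visible-beyond-neighbour : ∀ g t {v} → v ∈ drop 1 (visible t g) → suc (suc t) ≤ v
  visible-beyond-neighbour g t v∈ =
    increasing-head (subst Increasing (visible-unfold g t) (visible-increasing g t)) v∈

  ∈-visible-tail : ∀ g t {v} → v ∈ visible t g → suc t < v → v ∈ drop 1 (visible t g)
  ∈-visible-tail g t v∈ t+1<v with subst (_ ∈_) (visible-unfold g t) v∈
  ... | here refl = ⊥-elim (<-irrefl refl t+1<v)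
  ... | there v∈′ = v∈′

  visible-last : ∀ g t → suc (t + g) ∈ visible t g
  visible-last zero t rewrite +-identityʳ t = here refl
  visible-last (suc g) t rewrite +-suc t g =
    there (∈-dropKeepingLast (c (suc t)) (visible-increasing g (suc t)) (visible-last g (suc t))
           (λ l∈ → proj₂ (visible-range g (suc t) (∈-drop1⁻ (∈-take⁻ (c (suc t)) l∈)))))

  -- The canonical triangulation with these counts: row t + 1 joins t + 1 to the
  -- first c (t + 1) vertices it sees beyond t + 2, and row 0 joins 0 to all the
  -- vertices it sees except its neighbours 1 and n + 1.
  canonicalRow : ℕ → List ℕ
  canonicalRow zero = allButLast (drop 1 (visible 0 n))
  canonicalRow (suc t) = take (c (suc t)) (drop 1 (visible (suc t) (n ∸ suc t)))

  canonical-vanish-beyond : ∀ t → n < suc t → canonicalRow (suc t) ≡ []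
  canonical-vanish-beyond t n<t+1 rewrite m≤n⇒m∸n≡0 (<⇒≤ n<t+1) = take-[] (c (suc t))

  CanonicalBeyond : (ℕ → List ℕ) → ℕ → Set
  CanonicalBeyond R t = ∀ t′ → t < t′ → R t′ ≡ canonicalRow t′

  canonicalBeyond-step : ∀ {R t} → CanonicalBeyond R t → CanonicalBeyond R (suc t)
  canonicalBeyond-step canon t′ t+1<t′ = canon t′ (<-trans (n<1+n _) t+1<t′)

  canonical-next-row : ∀ {R t g} → suc t + g ≡ n → CanonicalBeyond R t →
                       R (suc t) ≡ take (c (suc t)) (drop 1 (visible (suc t) g))
  canonical-next-row {R} {t} {g} eq canon =
    trans (canon (suc t) ≤-refl) (cong (λ x → take (c (suc t)) (drop 1 (visible (suc t) x))) (gap-size {suc t} eq))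

  Unobstructed : (ℕ → List ℕ) → ℕ → ℕ → Set
  Unobstructed R t v = t < v × v ≤ suc n × (∀ k l → l ∈ R k → t < k → k < v → l ≤ v)

  Hidden : (ℕ → List ℕ) → ℕ → ℕ → Set
  Hidden R t v = ∃ λ k → ∃ λ l → l ∈ R k × t < k × k < v × v < l

  neighbour-unobstructed : ∀ R {t g} → t + g ≡ n → Unobstructed R t (suc t)
  neighbour-unobstructed R {t} {g} eq =
    ≤-refl , s≤s (≤-trans (m≤m+n t g) (≤-reflexive eq)) , λ k l _ t<k k<t+1 → ⊥-elim (<⇒≱ t<k (≤-pred k<t+1))

  visible⇒unobstructed : ∀ g t R → t + g ≡ n → CanonicalBeyond R t → ∀ {v} → v ∈ visible t g → Unobstructed R t v
  visible⇒unobstructed zero t R eq canon (here refl) = neighbour-unobstructed R eq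
  visible⇒unobstructed (suc g) t R eq canon (here refl) = neighbour-unobstructed R eq
  visible⇒unobstructed (suc g) t R eq canon {v} (there v∈)
    with visible⇒unobstructed g (suc t) R (gap-step eq) (canonicalBeyond-step canon) (dropKeepingLast⊆ (c (suc t)) v∈)
  ... | t+1<v , v≤ , clear = <-trans (n<1+n t) t+1<v , v≤ , clear′
    where
    clear′ : ∀ k l → l ∈ R k → t < k → k < v → l ≤ v
    clear′ k l l∈ t<k k<v with k ≟ suc t
    ... | yes refl = dropKeepingLast-above (c (suc t)) (visible-increasing g (suc t)) v∈
                       (subst (l ∈_) (canonical-next-row (gap-step eq) canon) l∈)
    ... | no k≢ = clear k l l∈ (≤∧≢⇒< t<k (λ k≡ → k≢ (sym k≡))) k<v

  invisible⇒hidden : ∀ g t R → t + g ≡ n → CanonicalBeyond R t → ∀ {v} → t < v → v ≤ suc n →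
                     v ∉ visible t g → Hidden R t v
  invisible⇒hidden zero t R eq canon {v} t<v v≤ v∉ =
    ⊥-elim (v∉ (here (≤-antisym (≤-trans v≤ (s≤s (≤-reflexive (trans (sym eq) (+-identityʳ t))))) t<v)))
  invisible⇒hidden (suc g) t R eq canon {v} t<v v≤ v∉ with v ≟ suc t
  ... | yes refl = ⊥-elim (v∉ (here refl))
  ... | no v≢ with v ∈? visible (suc t) g
  ...   | yes v∈ with ∉-dropKeepingLast (c (suc t)) (visible-increasing g (suc t)) v∈ (λ v∈′ → v∉ (there v∈′))
  ...     | l , l∈ , v<l = suc t , l , subst (l ∈_) (sym (canonical-next-row (gap-step eq) canon)) l∈ ,
                           ≤-refl , ≤∧≢⇒< t<v (λ v≡ → v≢ (sym v≡)) , v<l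
  invisible⇒hidden (suc g) t R eq canon {v} t<v v≤ v∉ | no v≢ | no v∉′
    with invisible⇒hidden g (suc t) R (gap-step eq) (canonicalBeyond-step canon) (≤∧≢⇒< t<v (λ v≡ → v≢ (sym v≡))) v≤ v∉′
  ... | k , l , l∈ , t+1<k , k<v , v<l = k , l , l∈ , <-trans (n<1+n t) t+1<k , k<v , v<l

  unobstructed⇒visible : ∀ g t R → t + g ≡ n → CanonicalBeyond R t → ∀ {v} → Unobstructed R t v → v ∈ visible t g
  unobstructed⇒visible g t R eq canon {v} (t<v , v≤ , clear) with v ∈? visible t g
  ... | yes v∈ = v∈
  ... | no v∉ with invisible⇒hidden g t R eq canon t<v v≤ v∉
  ...   | k , l , l∈ , t<k , k<v , v<l = ⊥-elim (<⇒≱ v<l (clear k l l∈ t<k k<v))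

  -- Counting: the diagonals with tails in (t, n] plus the vertices visible from t
  -- number n - t + 1, provided each vertex k > t keeps some vertex visible, i.e.
  -- c k is less than the number of vertices visible from k.
  LengthInvariant : ℕ → ℕ → Set
  LengthInvariant g t = sumFrom c (suc t) g + length (visible t g) ≡ suc g

  visible-length : (∀ g t → suc t + g ≡ n → LengthInvariant g (suc t) → c (suc t) < length (visible (suc t) g)) →
                   ∀ g t → t + g ≡ n → LengthInvariant g t
  visible-length fits zero t eq = refl
  visible-length fits (suc g) t eq = begin
      (c (suc t) + S) + suc (length (dropKeepingLast (c (suc t)) V))
    ≡⟨ cong (λ x → (c (suc t) + S) + suc x) (length-dropKeepingLast (c (suc t)) V fit) ⟩
      (c (suc t) + S) + suc (length V ∸ c (suc t))
    ≡⟨ +-suc (c (suc t) + S) (length V ∸ c (suc t)) ⟩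
      suc ((c (suc t) + S) + (length V ∸ c (suc t)))
    ≡⟨ cong suc (trans (cong (_+ (length V ∸ c (suc t))) (+-comm (c (suc t)) S)) (+-assoc S (c (suc t)) _)) ⟩
      suc (S + (c (suc t) + (length V ∸ c (suc t))))
    ≡⟨ cong (λ x → suc (S + x)) (m+[n∸m]≡n (<⇒≤ fit)) ⟩
      suc (S + length V)
    ≡⟨ cong suc invariant ⟩
      suc (suc g) ∎
    where
    open ≡-Reasoning
    S : ℕ
    S = sumFrom c (suc (suc t)) g
    V : List ℕ
    V = visible (suc t) g
    invariant : LengthInvariant g (suc t)
    invariant = visible-length fits g (suc t) (gap-step eq)
    fit : c (suc t) < length V
    fit = fits g t (gap-step eq) invariant

  -- Every vertex k ≥ 1 keeps a visible vertex after placing its diagonals.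
  RowsFit : Set
  RowsFit = ∀ g t → suc t + g ≡ n → c (suc t) < length (visible (suc t) g)

  fit⇒bounded : RowsFit → CountsBounded n c
  fit⇒bounded fits g t eq = ≤-pred (begin-strict
      c (suc t) + sumFrom c (suc (suc t)) g
    <⟨ +-monoˡ-< _ (fits g t eq) ⟩
      length (visible (suc t) g) + sumFrom c (suc (suc t)) g
    ≡⟨ trans (+-comm (length (visible (suc t) g)) _) (visible-length (λ g′ t′ eq′ _ → fits g′ t′ eq′) g (suc t) eq) ⟩
      suc g ∎)
    where open ≤-Reasoning

  bounded-fit : CountsBounded n c → ∀ g t → suc t + g ≡ n → LengthInvariant g (suc t) → c (suc t) < length (visible (suc t) g)
  bounded-fit bounded g t eq invariant = +-cancelʳ-< _ _ _ (begin-strict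
      c (suc t) + sumFrom c (suc (suc t)) g
    ≤⟨ bounded g t eq ⟩
      g
    <⟨ n<1+n g ⟩
      suc g
    ≡⟨ sym (trans (+-comm (length (visible (suc t) g)) _) invariant) ⟩
      length (visible (suc t) g) + sumFrom c (suc (suc t)) g ∎)
    where open ≤-Reasoning

  bounded⇒fit : CountsBounded n c → RowsFit
  bounded⇒fit bounded g t eq =
    bounded-fit bounded g t eq (visible-length (bounded-fit bounded) g (suc t) eq)

Crossing : ℕ → ℕ → ℕ → ℕ → Set
Crossing i j k l = (i < k × k < j × j < l) ⊎ (k < i × i < l × l < j)

record RowTriangulation (n : ℕ) (R : ℕ → List ℕ) : Set where
  field
    increasing  : ∀ i → Increasing (R i)
    bounded     : ∀ i j → j ∈ R i → j ≤ suc n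
    diagonal    : ∀ i j → j ∈ R i → i + 2 ≤ j × ¬ (i ≡ 0 × j ≡ suc n)
    nonCrossing : ∀ i j k l → j ∈ R i → l ∈ R k → ¬ Crossing i j k l
    maximal     : ∀ i j → i + 2 ≤ j → j ≤ suc n → ¬ (i ≡ 0 × j ≡ suc n) → j ∉ R i →
                  ∃ λ k → ∃ λ l → l ∈ R k × Crossing i j k l

diagonal-vertices : ∀ {n R} → RowTriangulation n R → ∀ {i j} → j ∈ R i → i < j × j < suc (suc n)
diagonal-vertices T {i} {j} j∈ =
  ≤-trans (≤-trans (n≤1+n (suc i)) (≤-reflexive (+-comm 2 i))) (proj₁ (RowTriangulation.diagonal T i j j∈)) ,
  s≤s (RowTriangulation.bounded T i j j∈)

-- Rigidity: a triangulation is the canonical one for its own row counts, so it is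
-- determined by them; moreover its counts satisfy the fit condition.
module Rigidity (n : ℕ) (R : ℕ → List ℕ) (T : RowTriangulation n R) where
  open RowTriangulation T
  open Visibility n (length ∘ R)

  rows-vanish-beyond : ∀ t → n < t → R t ≡ []
  rows-vanish-beyond t n<t = empty (λ j∈ → <⇒≱ n<t (tail≤n j∈))
    where
    tail≤n : ∀ {j} → j ∈ R t → t ≤ n
    tail≤n j∈ with diagonal-vertices T j∈
    ... | t<j , j<N = ≤-pred (≤-trans t<j (≤-pred j<N))
    empty : ∀ {xs : List ℕ} → (∀ {j} → j ∉ xs) → xs ≡ []
    empty {[]} _ = refl
    empty {x ∷ xs} none = ⊥-elim (none (here refl))

  -- Row t + 1 is canonical once the rows beyond it are: its heads are visible
  -- from t + 1 (non-crossing) and form an initial segment of the visible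
  -- vertices beyond t + 2 (maximality).
  row-canonical : ∀ g t → suc t + g ≡ n → CanonicalBeyond R (suc t) → R (suc t) ≡ canonicalRow (suc t)
  row-canonical g t eq canon =
    trans (initial-segment (increasing (suc t)) (visible-tail-increasing g (suc t)) sub closed)
          (cong (λ x → take (length (R (suc t))) (drop 1 (visible (suc t) x))) (sym (gap-size {suc t} eq)))
    where
    beyond : ∀ {j} → j ∈ R (suc t) → suc (suc t) < j
    beyond {j} j∈ = ≤-trans (≤-reflexive (+-comm 2 (suc t))) (proj₁ (diagonal (suc t) j j∈))
    unobstructed : ∀ {j} → j ∈ R (suc t) → Unobstructed R (suc t) j
    unobstructed {j} j∈ = <⇒≤ (beyond j∈) , bounded (suc t) j j∈ , clear
      where
      clear : ∀ k l → l ∈ R k → suc t < k → k < j → l ≤ j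
      clear k l l∈ t+1<k k<j with l ≤? j
      ... | yes l≤j = l≤j
      ... | no l≰j = ⊥-elim (nonCrossing (suc t) j k l j∈ l∈ (inj₁ (t+1<k , k<j , ≰⇒> l≰j)))
    sub : ∀ {j} → j ∈ R (suc t) → j ∈ drop 1 (visible (suc t) g)
    sub j∈ = ∈-visible-tail g (suc t) (unobstructed⇒visible g (suc t) R eq canon (unobstructed j∈)) (beyond j∈)
    closed : ∀ {j w} → j ∈ R (suc t) → w ∈ drop 1 (visible (suc t) g) → w < j → w ∈ R (suc t)
    closed {j} {w} j∈ w∈ w<j with w ∈? R (suc t)
    ... | yes w∈R = w∈R
    ... | no w∉R with maximal (suc t) w diagonal-w w≤ (λ { (() , _) }) w∉R
      where
      diagonal-w : suc t + 2 ≤ w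
      diagonal-w = ≤-trans (≤-reflexive (+-comm (suc t) 2)) (visible-beyond-neighbour g (suc t) w∈)
      w≤ : w ≤ suc n
      w≤ = ≤-trans (proj₂ (visible-range g (suc t) (∈-drop1⁻ w∈))) (≤-reflexive (cong suc eq))
    ... | k , l , l∈ , inj₁ (t+1<k , k<w , w<l) =
          ⊥-elim (<⇒≱ w<l (proj₂ (proj₂ (visible⇒unobstructed g (suc t) R eq canon (∈-drop1⁻ w∈))) k l l∈ t+1<k k<w))
    ... | k , l , l∈ , inj₂ (k<t+1 , t+1<l , l<w) =
          ⊥-elim (nonCrossing (suc t) j k l j∈ l∈ (inj₂ (k<t+1 , t+1<l , <-trans l<w w<j)))

  rows-canonical : ∀ g t → t + g ≡ n → CanonicalBeyond R t
  rows-canonical zero t eq (suc t′) t<t′+1 =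
    trans (rows-vanish-beyond (suc t′) n<t′+1) (sym (canonical-vanish-beyond t′ n<t′+1))
    where
    n<t′+1 : n < suc t′
    n<t′+1 = ≤-trans (s≤s (≤-reflexive (trans (sym eq) (+-identityʳ t)))) t<t′+1
  rows-canonical (suc g) t eq t′ t<t′ with t′ ≟ suc t
  ... | yes refl = row-canonical g t (gap-step eq) (rows-canonical g (suc t) (gap-step eq))
  ... | no t′≢ = rows-canonical g (suc t) (gap-step eq) t′ (≤∧≢⇒< t<t′ (λ t′≡ → t′≢ (sym t′≡)))

  -- Row t + 1 uses only part of the vertices seen from t + 1 (never t + 2 itself).
  rows-fit : RowsFit
  rows-fit g t eq = begin-strict
      length (R (suc t))
    ≡⟨ cong length (row-canonical g t eq (rows-canonical g (suc t) eq)) ⟩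
      length (take (length (R (suc t))) (drop 1 (visible (suc t) (n ∸ suc t))))
    ≡⟨ cong (λ x → length (take (length (R (suc t))) (drop 1 (visible (suc t) x)))) (gap-size {suc t} eq) ⟩
      length (take (length (R (suc t))) (drop 1 (visible (suc t) g)))
    ≤⟨ ≤-trans (≤-reflexive (length-take (length (R (suc t))) (drop 1 (visible (suc t) g)))) (m⊓n≤n _ _) ⟩
      length (drop 1 (visible (suc t) g))
    <⟨ ≤-reflexive (cong length (sym (visible-unfold g (suc t)))) ⟩
      length (visible (suc t) g) ∎
    where open ≤-Reasoning

visible-cong : ∀ n c c′ → (∀ t → c (suc t) ≡ c′ (suc t)) → ∀ g t →
               Visibility.visible n c t g ≡ Visibility.visible n c′ t g
visible-cong n c c′ same zero t = refl
visible-cong n c c′ same (suc g) t =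
  cong₂ (λ a xs → suc t ∷ dropKeepingLast a xs) (same t) (visible-cong n c c′ same g (suc t))

-- In a triangulation, row 0 consists of the diagonals from 0 not crossed by
-- the other rows; so it is determined by them.
row-zero-determined : ∀ {n R R′} → RowTriangulation n R → RowTriangulation n R′ →
                      (∀ t → R (suc t) ≡ R′ (suc t)) → ∀ {j} → j ∈ R 0 → j ∈ R′ 0
row-zero-determined {R = R} {R′} T T′ same {j} j∈ with j ∈? R′ 0
... | yes j∈′ = j∈′
... | no j∉′ with RowTriangulation.maximal T′ 0 j (proj₁ (RowTriangulation.diagonal T 0 j j∈))
                    (RowTriangulation.bounded T 0 j j∈) (proj₂ (RowTriangulation.diagonal T 0 j j∈)) j∉′
...   | suc k , l , l∈ , inj₁ crossing =
        ⊥-elim (RowTriangulation.nonCrossing T 0 j (suc k) l j∈ (subst (l ∈_) (sym (same k)) l∈) (inj₁ crossing))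
...   | zero , l , l∈ , inj₁ (() , _)
...   | k , l , l∈ , inj₂ (() , _)

determined-by-counts : ∀ {n R R′} → RowTriangulation n R → RowTriangulation n R′ →
                       (∀ t → length (R (suc t)) ≡ length (R′ (suc t))) → ∀ t → R t ≡ R′ t
determined-by-counts {n} {R} {R′} T T′ same zero =
  same-members (RowTriangulation.increasing T 0) (RowTriangulation.increasing T′ 0)
    (row-zero-determined T T′ positive-rows) (row-zero-determined T′ T (sym ∘ positive-rows))
  where
  positive-rows : ∀ t → R (suc t) ≡ R′ (suc t)
  positive-rows t = determined-by-counts T T′ same (suc t)
determined-by-counts {n} {R} {R′} T T′ same (suc t) = begin
    R (suc t)
  ≡⟨ Rigidity.rows-canonical n R T n 0 refl (suc t) (s≤s z≤n) ⟩
    take (length (R (suc t))) (drop 1 (Visibility.visible n (length ∘ R) (suc t) (n ∸ suc t)))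
  ≡⟨ cong₂ take (same t) (cong (drop 1) (visible-cong n (length ∘ R) (length ∘ R′) same (n ∸ suc t) (suc t))) ⟩
    take (length (R′ (suc t))) (drop 1 (Visibility.visible n (length ∘ R′) (suc t) (n ∸ suc t)))
  ≡⟨ sym (Rigidity.rows-canonical n R′ T′ n 0 refl (suc t) (s≤s z≤n)) ⟩
    R′ (suc t) ∎
  where open ≡-Reasoning

module Canonical (n : ℕ) (c : ℕ → ℕ) where
  open Visibility n c

  canonical-beyond : ∀ t → CanonicalBeyond canonicalRow t
  canonical-beyond t t′ _ = refl

  canonicalRow⊆ : ∀ t {j} → j ∈ canonicalRow t → t ≤ n × j ∈ drop 1 (visible t (n ∸ t))
  canonicalRow⊆ zero j∈ = z≤n , ∈-take⁻ _ j∈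
  canonicalRow⊆ (suc t) {j} j∈ with suc t ≤? n
  ... | yes t+1≤n = t+1≤n , ∈-take⁻ (c (suc t)) j∈
  ... | no t+1≰n with ∈-take⁻ (c (suc t)) (subst (λ x → j ∈ take (c (suc t)) (drop 1 (visible (suc t) x)))
                                                 (m≤n⇒m∸n≡0 (<⇒≤ (≰⇒> t+1≰n))) j∈)
  ...   | ()

  canonicalRow-visible : ∀ t {j} → j ∈ canonicalRow t → j ∈ visible t (n ∸ t)
  canonicalRow-visible t j∈ = ∈-drop1⁻ (proj₂ (canonicalRow⊆ t j∈))

  canonicalRow-increasing : ∀ t → Increasing (canonicalRow t)
  canonicalRow-increasing zero = take⁺ _ (visible-tail-increasing n 0)
  canonicalRow-increasing (suc t) = take⁺ _ (visible-tail-increasing (n ∸ suc t) (suc t))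

  -- Heads are visible, so no canonical diagonal passes over them.
  canonical-nonCrossing : ∀ i j k l → j ∈ canonicalRow i → l ∈ canonicalRow k → ¬ Crossing i j k l
  canonical-nonCrossing i j k l j∈ l∈ (inj₁ (i<k , k<j , j<l)) =
    <⇒≱ j<l (proj₂ (proj₂ (visible⇒unobstructed (n ∸ i) i canonicalRow (m+[n∸m]≡n (proj₁ (canonicalRow⊆ i j∈)))
                                 (canonical-beyond i) (canonicalRow-visible i j∈))) k l l∈ i<k k<j)
  canonical-nonCrossing i j k l j∈ l∈ (inj₂ (k<i , i<l , l<j)) =
    <⇒≱ l<j (proj₂ (proj₂ (visible⇒unobstructed (n ∸ k) k canonicalRow (m+[n∸m]≡n (proj₁ (canonicalRow⊆ k l∈)))
                                 (canonical-beyond k) (canonicalRow-visible k l∈))) i j j∈ k<i i<l)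

  -- Canonical chords skip the neighbour t + 1, and row 0 omits the side (0 , n + 1).
  canonical-diagonal : ∀ i j → j ∈ canonicalRow i → i + 2 ≤ j × ¬ (i ≡ 0 × j ≡ suc n)
  canonical-diagonal i j j∈ =
    ≤-trans (≤-reflexive (+-comm i 2)) (visible-beyond-neighbour (n ∸ i) i (proj₂ (canonicalRow⊆ i j∈))) , not-side i j∈
    where
    not-side : ∀ i → j ∈ canonicalRow i → ¬ (i ≡ 0 × j ≡ suc n)
    not-side zero j∈ (_ , refl) with allButLast-below (visible-tail-increasing n 0) j∈
    ... | y , y∈ , n+1<y = <⇒≱ n+1<y (proj₂ (visible-range n 0 (∈-drop1⁻ y∈)))
    not-side (suc i) j∈ (() , _)

  canonical-bounded : ∀ i j → j ∈ canonicalRow i → j ≤ suc n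
  canonical-bounded i j j∈ =
    ≤-trans (proj₂ (visible-range (n ∸ i) i (canonicalRow-visible i j∈)))
            (s≤s (≤-reflexive (m+[n∸m]≡n (proj₁ (canonicalRow⊆ i j∈)))))

  -- Since n ≥ 1, the last vertex n + 1 is seen from 0 beyond its neighbour 1.
  module _ (n≥1 : 1 ≤ n) where

    last-beyond-0 : suc n ∈ drop 1 (visible 0 n)
    last-beyond-0 = ∈-visible-tail n 0 (visible-last n 0) (s≤s n≥1)

    -- A vertex u with i < u < j that is visible from some t < i is passed over by
    -- a canonical diagonal crossing (i , j): descend from t towards 0 until a row
    -- reaches into (i , j); row 0 reaches u itself.
    covered-from-below : ∀ i j u t g → t + g ≡ n → t < i → u ∈ visible t g → i < u → u < j → j ≤ suc n →
                         ∃ λ k → ∃ λ l → l ∈ canonicalRow k × Crossing i j k l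
    covered-from-below i j u zero .n refl 0<i u∈ i<u u<j j≤ =
      0 , u , ∈-allButLast (visible-tail-increasing n 0) (∈-visible-tail n 0 u∈ (≤-<-trans 0<i i<u)) last-beyond-0 (<-≤-trans u<j j≤) ,
      inj₂ (0<i , i<u , u<j)
    covered-from-below i j u (suc t) g eq t<i u∈ i<u u<j j≤
      with any? (λ l → (i <? l) ×-dec (l <? j)) (canonicalRow (suc t))
    ... | yes reaches with find reaches
    ...   | l , l∈ , i<l , l<j = suc t , l , l∈ , inj₂ (t<i , i<l , l<j)
    covered-from-below i j u (suc t) g eq t<i u∈ i<u u<j j≤ | no misses =
      covered-from-below i j u t (suc g) (trans (+-suc t g) eq) (<-trans (n<1+n t) t<i)
        (there (∈-dropKeepingLast (c (suc t)) (visible-increasing g (suc t)) u∈ below-u)) i<u u<j j≤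
      where
      row : canonicalRow (suc t) ≡ take (c (suc t)) (drop 1 (visible (suc t) g))
      row = cong (λ x → take (c (suc t)) (drop 1 (visible (suc t) x))) (gap-size {suc t} eq)
      below-u : ∀ {l} → l ∈ take (c (suc t)) (drop 1 (visible (suc t) g)) → l ≤ u
      below-u {l} l∈ with l ≤? u
      ... | yes l≤u = l≤u
      ... | no l≰u with l <? j
      ...   | yes l<j = ⊥-elim (misses (lose (subst (l ∈_) (sym row) l∈) (<-trans i<u (≰⇒> l≰u) , l<j)))
      ...   | no l≮j = ⊥-elim (misses (lose (subst (u ∈_) (sym row)
                (take-downward-closed (c (suc t)) (visible-tail-increasing g (suc t))
                   (∈-visible-tail g (suc t) u∈ (≤-trans (s≤s t<i) i<u)) l∈ (≰⇒> l≰u))) (i<u , u<j)))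

    -- A missing diagonal (i , j) is crossed: either j is hidden from i, or it lies
    -- beyond the c i heads of row i and a smaller vertex u visible from i - 1 is
    -- covered from below.
    canonical-maximal : ∀ i j → i + 2 ≤ j → j ≤ suc n → ¬ (i ≡ 0 × j ≡ suc n) → j ∉ canonicalRow i →
                        ∃ λ k → ∃ λ l → l ∈ canonicalRow k × Crossing i j k l
    canonical-maximal i j i+2≤j j≤ not-side j∉ with j ∈? visible i (n ∸ i)
    ... | no j-invisible with invisible⇒hidden (n ∸ i) i canonicalRow (m+[n∸m]≡n i≤n) (canonical-beyond i) i<j j≤ j-invisible
      where
      i<j : i < j
      i<j = ≤-trans (≤-trans (n≤1+n (suc i)) (≤-reflexive (+-comm 2 i))) i+2≤j
      i≤n : i ≤ n
      i≤n = ≤-pred (≤-trans i<j j≤)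
    ...   | k , l , l∈ , i<k , k<j , j<l = k , l , l∈ , inj₁ (i<k , k<j , j<l)
    canonical-maximal zero j i+2≤j j≤ not-side j∉ | yes j-visible =
      ⊥-elim (j∉ (∈-allButLast (visible-tail-increasing n 0) (∈-visible-tail n 0 j-visible i+2≤j) last-beyond-0
                   (≤∧≢⇒< j≤ (λ j≡ → not-side (refl , j≡)))))
    canonical-maximal (suc i) j i+2≤j j≤ not-side j∉ | yes j-visible
      with dropKeepingLast-below (c (suc i)) (visible-increasing (n ∸ suc i) (suc i)) j-beyond j∉
      where
      j-beyond : j ∈ drop 1 (visible (suc i) (n ∸ suc i))
      j-beyond = ∈-visible-tail (n ∸ suc i) (suc i) j-visible (≤-trans (≤-reflexive (+-comm 2 (suc i))) i+2≤j)
    ... | u , u∈ , u<j =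
      covered-from-below (suc i) j u i (suc (n ∸ suc i)) (trans (+-suc i (n ∸ suc i)) (m+[n∸m]≡n i+1≤n)) ≤-refl
        (there u∈) (proj₁ (visible-range (n ∸ suc i) (suc i) (dropKeepingLast⊆ (c (suc i)) u∈))) u<j j≤
      where
      i+1≤n : suc i ≤ n
      i+1≤n = ≤-pred (≤-trans (≤-trans (n≤1+n (suc (suc i))) (≤-reflexive (+-comm 2 (suc i)))) (≤-trans i+2≤j j≤))

    canonical-triangulation : RowTriangulation n canonicalRow
    canonical-triangulation = record
      { increasing = canonicalRow-increasing
      ; bounded = canonical-bounded
      ; diagonal = canonical-diagonal
      ; nonCrossing = canonical-nonCrossing
      ; maximal = canonical-maximal
      }

  canonical-row-length : CountsBounded n c → ∀ t → suc t ≤ n → length (canonicalRow (suc t)) ≡ c (suc t)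
  canonical-row-length bounded t t+1≤n =
    trans (length-take (c (suc t)) (drop 1 (visible (suc t) g)))
          (m≤n⇒m⊓n≡m (≤-pred (≤-trans (bounded⇒fit bounded g t eq) (≤-reflexive (cong length (visible-unfold g (suc t)))))))
    where
    g : ℕ
    g = n ∸ suc t
    eq : suc t + g ≡ n
    eq = m+[n∸m]≡n t+1≤n

tails-as-blocks : ∀ m (f : Fin m → ℕ) (h : ℕ → ℕ) → (∀ i → f i ≡ h (toℕ i)) →
                  concatMap (λ i → replicate (f i) (toℕ i)) (reverse (List.allFin m)) ≡ blocks m h
tails-as-blocks zero f h eq = refl
tails-as-blocks (suc m) f h eq = begin
    concatMap F (reverse (List.allFin (suc m)))
  ≡⟨ cong (λ xs → concatMap F (reverse (fzero ∷ xs))) (sym (map-tabulate id fsuc)) ⟩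
    concatMap F (reverse (fzero ∷ map fsuc (List.allFin m)))
  ≡⟨ cong (concatMap F) (unfold-reverse fzero (map fsuc (List.allFin m))) ⟩
    concatMap F (reverse (map fsuc (List.allFin m)) ++ (fzero ∷ []))
  ≡⟨ concatMap-++ F (reverse (map fsuc (List.allFin m))) (fzero ∷ []) ⟩
    concatMap F (reverse (map fsuc (List.allFin m))) ++ (F fzero ++ [])
  ≡⟨ cong₂ _++_ (cong (concatMap F) (sym (reverse-map fsuc (List.allFin m)))) (++-identityʳ (F fzero)) ⟩
    concatMap F (map fsuc (reverse (List.allFin m))) ++ F fzero
  ≡⟨ cong (_++ F fzero) (concatMap-map F fsuc (reverse (List.allFin m))) ⟩
    concatMap (F ∘ fsuc) (reverse (List.allFin m)) ++ F fzero
  ≡⟨ cong (_++ F fzero) (concatMap-cong (λ i → sym (map-replicate suc (f (fsuc i)) (toℕ i))) (reverse (List.allFin m))) ⟩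
    concatMap (map suc ∘ G) (reverse (List.allFin m)) ++ F fzero
  ≡⟨ cong (_++ F fzero) (sym (map-concatMap suc G (reverse (List.allFin m)))) ⟩
    map suc (concatMap G (reverse (List.allFin m))) ++ F fzero
  ≡⟨ cong₂ (λ xs a → map suc xs ++ replicate a 0) (tails-as-blocks m (f ∘ fsuc) (h ∘ suc) (eq ∘ fsuc)) (eq fzero) ⟩
    blocks (suc m) h ∎
  where
  open ≡-Reasoning
  F : Fin (suc m) → List ℕ
  F i = replicate (f i) (toℕ i)
  G : Fin m → List ℕ
  G i = replicate (f (fsuc i)) (toℕ i)

-- ℕ-indexed access to Boolean vectors and matrices, false outside the range.
bitAt : ∀ {m} → Vec Bool m → ℕ → Bool
bitAt Vec.[] _ = false
bitAt (b Vec.∷ bs) zero = b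
bitAt (b Vec.∷ bs) (suc j) = bitAt bs j

rowAt : ∀ {m k} → Vec (Vec Bool m) k → ℕ → Vec Bool m
rowAt Vec.[] t = Vec.replicate _ false
rowAt (r Vec.∷ rs) zero = r
rowAt (r Vec.∷ rs) (suc t) = rowAt rs t

lookup-bitAt : ∀ {m} (v : Vec Bool m) (j : Fin m) → lookup v j ≡ bitAt v (toℕ j)
lookup-bitAt (b Vec.∷ bs) fzero = refl
lookup-bitAt (b Vec.∷ bs) (fsuc j) = lookup-bitAt bs j

lookup-rowAt : ∀ {m k} (A : Vec (Vec Bool m) k) (i : Fin k) → lookup A i ≡ rowAt A (toℕ i)
lookup-rowAt (r Vec.∷ rs) fzero = refl
lookup-rowAt (r Vec.∷ rs) (fsuc i) = lookup-rowAt rs i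

bitAt-false : ∀ m j → bitAt (Vec.replicate m false) j ≡ false
bitAt-false zero j = refl
bitAt-false (suc m) zero = refl
bitAt-false (suc m) (suc j) = bitAt-false m j

rowAt-beyond : ∀ {m k} (A : Vec (Vec Bool m) k) t j → k ≤ t → bitAt (rowAt A t) j ≡ false
rowAt-beyond {m} Vec.[] t j _ = bitAt-false m j
rowAt-beyond (r Vec.∷ rs) (suc t) j (s≤s k≤t) = rowAt-beyond rs t j k≤t

bitAt-ext : ∀ {m} (v w : Vec Bool m) → (∀ j → j < m → bitAt v j ≡ bitAt w j) → v ≡ w
bitAt-ext Vec.[] Vec.[] _ = refl
bitAt-ext (b Vec.∷ bs) (c Vec.∷ cs) same = cong₂ Vec._∷_ (same 0 (s≤s z≤n)) (bitAt-ext bs cs (λ j j<m → same (suc j) (s≤s j<m)))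

rowAt-ext : ∀ {m k} (A B : Vec (Vec Bool m) k) → (∀ t → t < k → rowAt A t ≡ rowAt B t) → A ≡ B
rowAt-ext Vec.[] Vec.[] _ = refl
rowAt-ext (r Vec.∷ rs) (s Vec.∷ ss) same = cong₂ Vec._∷_ (same 0 (s≤s z≤n)) (rowAt-ext rs ss (λ t t<k → same (suc t) (s≤s t<k)))

bitAt-tabulate : ∀ {m} (f : ℕ → Bool) j → j < m → bitAt (tabulate {n = m} (f ∘ toℕ)) j ≡ f j
bitAt-tabulate {suc m} f zero _ = refl
bitAt-tabulate {suc m} f (suc j) (s≤s j<m) = bitAt-tabulate (f ∘ suc) j j<m

rowAt-tabulate : ∀ {m k} (F : ℕ → Vec Bool m) t → t < k → rowAt (tabulate {n = k} (F ∘ toℕ)) t ≡ F t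
rowAt-tabulate {k = suc k} F zero _ = refl
rowAt-tabulate {k = suc k} F (suc t) (s≤s t<k) = rowAt-tabulate (F ∘ suc) t t<k

trueIndices : (ℕ → Bool) → ℕ → ℕ → List ℕ
trueIndices r a zero = []
trueIndices r a (suc m) = if r a then a ∷ trueIndices r (suc a) m else trueIndices r (suc a) m

∈-trueIndices⁻ : ∀ r a m {j} → j ∈ trueIndices r a m → a ≤ j × j < a + m × r j ≡ true
∈-trueIndices⁻ r a (suc m) {j} j∈ with r a in eq
∈-trueIndices⁻ r a (suc m) (here refl) | true = ≤-refl , ≤-trans (s≤s (m≤m+n a m)) (≤-reflexive (sym (+-suc a m))) , eq
∈-trueIndices⁻ r a (suc m) (there j∈) | true with ∈-trueIndices⁻ r (suc a) m j∈
... | a<j , j< , rj = <⇒≤ a<j , ≤-trans j< (≤-reflexive (sym (+-suc a m))) , rj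
∈-trueIndices⁻ r a (suc m) j∈ | false with ∈-trueIndices⁻ r (suc a) m j∈
... | a<j , j< , rj = <⇒≤ a<j , ≤-trans j< (≤-reflexive (sym (+-suc a m))) , rj

∈-trueIndices⁺ : ∀ r a m {j} → a ≤ j → j < a + m → r j ≡ true → j ∈ trueIndices r a m
∈-trueIndices⁺ r a zero a≤j j< _ = ⊥-elim (<⇒≱ j< (≤-trans (≤-reflexive (+-identityʳ a)) a≤j))
∈-trueIndices⁺ r a (suc m) {j} a≤j j< rj with j ≟ a
... | yes refl rewrite rj = here refl
... | no j≢a with r a
...   | true = there (∈-trueIndices⁺ r (suc a) m a<j j<′ rj)
  where
  a<j : a < j
  a<j = ≤∧≢⇒< a≤j (λ a≡ → j≢a (sym a≡))
  j<′ : j < suc a + m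
  j<′ = ≤-trans j< (≤-reflexive (+-suc a m))
...   | false = ∈-trueIndices⁺ r (suc a) m a<j j<′ rj
  where
  a<j : a < j
  a<j = ≤∧≢⇒< a≤j (λ a≡ → j≢a (sym a≡))
  j<′ : j < suc a + m
  j<′ = ≤-trans j< (≤-reflexive (+-suc a m))

trueIndices-increasing : ∀ r a m → Increasing (trueIndices r a m)
trueIndices-increasing r a zero = []
trueIndices-increasing r a (suc m) with r a
... | true = All.tabulate (λ j∈ → proj₁ (∈-trueIndices⁻ r (suc a) m j∈)) ∷ trueIndices-increasing r (suc a) m
... | false = trueIndices-increasing r (suc a) m

trueIndices-shift : ∀ r a m → trueIndices r (suc a) m ≡ map suc (trueIndices (r ∘ suc) a m)
trueIndices-shift r a zero = refl
trueIndices-shift r a (suc m) with r (suc a)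
... | true = cong (suc a ∷_) (trueIndices-shift r (suc a) m)
... | false = trueIndices-shift r (suc a) m

trueIndices-tail : ∀ {m} b (bs : Vec Bool m) →
                   length (trueIndices (bitAt bs) 0 m) ≡ length (trueIndices (bitAt (b Vec.∷ bs)) 1 m)
trueIndices-tail {m} b bs =
  trans (sym (length-map suc (trueIndices (bitAt bs) 0 m))) (cong length (sym (trueIndices-shift (bitAt (b Vec.∷ bs)) 0 m)))

countTrue-trueIndices : ∀ {m} (v : Vec Bool m) → countTrue v ≡ length (trueIndices (bitAt v) 0 m)
countTrue-trueIndices Vec.[] = refl
countTrue-trueIndices (true Vec.∷ bs) = cong suc (trans (countTrue-trueIndices bs) (trueIndices-tail true bs))
countTrue-trueIndices (false Vec.∷ bs) = trans (countTrue-trueIndices bs) (trueIndices-tail false bs)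

does-true : ∀ {P : Set} (p? : Dec P) → does p? ≡ true → P
does-true (yes p) _ = p

bool-ext : ∀ {a b : Bool} → (a ≡ true → b ≡ true) → (b ≡ true → a ≡ true) → a ≡ b
bool-ext {true} {true} _ _ = refl
bool-ext {true} {false} a⇒b _ = sym (a⇒b refl)
bool-ext {false} {true} _ b⇒a = b⇒a refl
bool-ext {false} {false} _ _ = refl

module Rows (n : ℕ) where

  N : ℕ
  N = suc (suc n)

  rows : DiagSet n → ℕ → List ℕ
  rows A t = trueIndices (bitAt (rowAt A t)) 0 N

  entry : ∀ (A : DiagSet n) i j → lookup (lookup A i) j ≡ bitAt (rowAt A (toℕ i)) (toℕ j)
  entry A i j = trans (lookup-bitAt (lookup A i) j) (cong (λ r → bitAt r (toℕ j)) (lookup-rowAt A i))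

  ∈D⇒∈rows : ∀ {A i j} → (i , j) ∈D A → toℕ j ∈ rows A (toℕ i)
  ∈D⇒∈rows {A} {i} {j} ij∈ = ∈-trueIndices⁺ (bitAt (rowAt A (toℕ i))) 0 N z≤n (toℕ<n j) (trans (sym (entry A i j)) ij∈)

  ∈rows⇒∈D : ∀ {A i j} → toℕ j ∈ rows A (toℕ i) → (i , j) ∈D A
  ∈rows⇒∈D {A} {i} {j} j∈ = trans (entry A i j) (proj₂ (proj₂ (∈-trueIndices⁻ (bitAt (rowAt A (toℕ i))) 0 N j∈)))

  rows-range : ∀ {A t j} → j ∈ rows A t → t < N × j < N
  rows-range {A} {t} {j} j∈ with ∈-trueIndices⁻ (bitAt (rowAt A t)) 0 N j∈
  ... | _ , j<N , bit with t <? N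
  ...   | yes t<N = t<N , j<N
  ...   | no t≮N with () ← trans (sym bit) (rowAt-beyond A t j (≮⇒≥ t≮N))

  vertex : ∀ {i} → i < N → ∃ λ (v : Vertex n) → toℕ v ≡ i
  vertex i<N = fromℕ< i<N , toℕ-fromℕ< i<N

  triangulation⇒rows : ∀ {A} → IsTriangulation n A → RowTriangulation n (rows A)
  triangulation⇒rows {A} T = record
    { increasing = λ i → trueIndices-increasing (bitAt (rowAt A i)) 0 N
    ; bounded = λ i j j∈ → ≤-pred (proj₂ (rows-range {A} j∈))
    ; diagonal = diagonal
    ; nonCrossing = nonCrossing
    ; maximal = maximal
    }
    where
    diagonal : ∀ i j → j ∈ rows A i → i + 2 ≤ j × ¬ (i ≡ 0 × j ≡ suc n)
    diagonal i j j∈ with vertex (proj₁ (rows-range {A} j∈)) | vertex (proj₂ (rows-range {A} j∈))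
    ... | vi , refl | vj , refl = IsTriangulation.onlyDiagonals T vi vj (∈rows⇒∈D {A} j∈)
    nonCrossing : ∀ i j k l → j ∈ rows A i → l ∈ rows A k → ¬ Crossing i j k l
    nonCrossing i j k l j∈ l∈ with vertex (proj₁ (rows-range {A} j∈)) | vertex (proj₂ (rows-range {A} j∈))
                                 | vertex (proj₁ (rows-range {A} l∈)) | vertex (proj₂ (rows-range {A} l∈))
    ... | vi , refl | vj , refl | vk , refl | vl , refl =
          IsTriangulation.nonCrossing T vi vj vk vl (∈rows⇒∈D {A} j∈) (∈rows⇒∈D {A} l∈)
    maximal : ∀ i j → i + 2 ≤ j → j ≤ suc n → ¬ (i ≡ 0 × j ≡ suc n) → j ∉ rows A i →
              ∃ λ k → ∃ λ l → l ∈ rows A k × Crossing i j k l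
    maximal i j i+2≤j j≤ not-side j∉ with vertex {i} (s≤s (≤-trans (m≤m+n i 2) (≤-trans i+2≤j j≤))) | vertex {j} (s≤s j≤)
    ... | vi , refl | vj , refl with IsTriangulation.maximal T vi vj (i+2≤j , not-side) (λ ij∈ → j∉ (∈D⇒∈rows {A} ij∈))
    ...   | vk , vl , kl∈ , crossing = toℕ vk , toℕ vl , ∈D⇒∈rows {A} kl∈ , crossing

  rows⇒triangulation : ∀ {A R} → (∀ t → rows A t ≡ R t) → RowTriangulation n R → IsTriangulation n A
  rows⇒triangulation {A} {R} same T = record
    { onlyDiagonals = λ i j ij∈ → RowTriangulation.diagonal T (toℕ i) (toℕ j) (to-R (∈D⇒∈rows {A} ij∈))
    ; nonCrossing = λ i j k l ij∈ kl∈ → RowTriangulation.nonCrossing T (toℕ i) (toℕ j) (toℕ k) (toℕ l)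
                                          (to-R (∈D⇒∈rows {A} ij∈)) (to-R (∈D⇒∈rows {A} kl∈))
    ; maximal = maximal
    }
    where
    to-R : ∀ {t j} → j ∈ rows A t → j ∈ R t
    to-R {t} {j} = subst (j ∈_) (same t)
    from-R : ∀ {t j} → j ∈ R t → j ∈ rows A t
    from-R {t} {j} = subst (j ∈_) (sym (same t))
    maximal : ∀ i j → IsDiagonal n i j → ¬ ((i , j) ∈D A) →
              Σ (Vertex n) λ k → Σ (Vertex n) λ l → ((k , l) ∈D A) × Cross i j k l
    maximal i j (i+2≤j , not-side) ij∉
      with RowTriangulation.maximal T (toℕ i) (toℕ j) i+2≤j (≤-pred (toℕ<n j)) not-side
             (λ j∈ → ij∉ (∈rows⇒∈D {A} (from-R j∈)))
    ... | k , l , l∈ , crossing with vertex (proj₁ (rows-range {A} (from-R l∈))) | vertex (proj₂ (rows-range {A} (from-R l∈)))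
    ...   | vk , refl | vl , refl = vk , vl , ∈rows⇒∈D {A} (from-R l∈) , crossing

  Λ-as-blocks : ∀ (A : DiagSet n) k → Λ A k ≡ nth (blocks N (length ∘ rows A)) k
  Λ-as-blocks A k = cong (λ xs → nth xs k)
    (tails-as-blocks N (λ i → countTrue (lookup A i)) (length ∘ rows A)
       (λ i → trans (cong countTrue (lookup-rowAt A i)) (countTrue-trueIndices (rowAt A (toℕ i)))))

  rows-injective : ∀ (A B : DiagSet n) → (∀ t → rows A t ≡ rows B t) → A ≡ B
  rows-injective A B same = rowAt-ext A B (λ t t<N → bitAt-ext _ _ (λ j j<N → bool-ext (transfer A B same t<N j<N)
                                                                               (transfer B A (sym ∘ same) t<N j<N)))
    where
    transfer : ∀ A B → (∀ t → rows A t ≡ rows B t) → ∀ {t j} → t < N → j < N →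
               bitAt (rowAt A t) j ≡ true → bitAt (rowAt B t) j ≡ true
    transfer A B same {t} {j} _ j<N bit =
      proj₂ (proj₂ (∈-trueIndices⁻ (bitAt (rowAt B t)) 0 N
        (subst (j ∈_) (same t) (∈-trueIndices⁺ (bitAt (rowAt A t)) 0 N z≤n j<N bit))))

  matrix : (ℕ → List ℕ) → DiagSet n
  matrix R = tabulate (λ i → tabulate (λ j → does (toℕ j ∈? R (toℕ i))))

  rows-matrix : ∀ R → RowTriangulation n R → ∀ t → rows (matrix R) t ≡ R t
  rows-matrix R T t =
    same-members (trueIndices-increasing (bitAt (rowAt (matrix R) t)) 0 N) (RowTriangulation.increasing T t) to-R from-R
    where
    bit : ∀ {j} → t < N → j < N → bitAt (rowAt (matrix R) t) j ≡ does (j ∈? R t)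
    bit {j} t<N j<N = trans (cong (λ r → bitAt r j) (rowAt-tabulate (λ t → tabulate (λ j → does (toℕ j ∈? R t))) t t<N))
                            (bitAt-tabulate (λ j → does (j ∈? R t)) j j<N)
    to-R : ∀ {j} → j ∈ rows (matrix R) t → j ∈ R t
    to-R {j} j∈ with ∈-trueIndices⁻ (bitAt (rowAt (matrix R) t)) 0 N j∈ | t <? N
    ... | _ , j<N , true-bit | yes t<N = does-true (j ∈? R t) (trans (sym (bit t<N j<N)) true-bit)
    ... | _ , j<N , true-bit | no t≮N with () ← trans (sym true-bit) (rowAt-beyond (matrix R) t j (≮⇒≥ t≮N))
    from-R : ∀ {j} → j ∈ R t → j ∈ rows (matrix R) t
    from-R {j} j∈ with diagonal-vertices T j∈
    ... | t<j , j<N = ∈-trueIndices⁺ (bitAt (rowAt (matrix R) t)) 0 N z≤n j<N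
                        (trans (bit (<-trans t<j j<N) j<N) (dec-true (j ∈? R t) j∈))

tails-beyond : ∀ t g → suc (suc (suc t + g)) ∸ suc t ≡ suc g + 1
tails-beyond zero g = cong suc (+-comm 1 g)
tails-beyond (suc t) g = tails-beyond t g

swap-∸ : ∀ n m k → suc k ≤ n ∸ m → m ≤ n ∸ suc k
swap-∸ n m k k<n-m = m+n≤o⇒m≤o∸n m (≤-trans (+-monoʳ-≤ m k<n-m) (≤-reflexive (m+[n∸m]≡n m≤n)))
  where
  m≤n : m ≤ n
  m≤n = <⇒≤ (m∸n≢0⇒n<m (λ n-m≡0 → <⇒≱ (≤-trans k<n-m (≤-reflexive n-m≡0)) z≤n))

InY-cong : ∀ {n d d′} → (∀ k → d k ≡ d′ k) → InY n d → InY n d′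
InY-cong {n} {d} {d′} same ((decreasing , N , vanish) , bound , zero-beyond) =
  ((λ k → subst₂ _≤_ (same (suc k)) (same k) (decreasing k)) , N , (λ k N≤k → trans (sym (same k)) (vanish k N≤k))) ,
  (λ k k+1≤ → subst (_≤ n ∸ suc k) (same k) (bound k k+1≤)) ,
  (λ k n≤k+1 → trans (sym (same k)) (zero-beyond k n≤k+1))

tails-from-bounded : ∀ n h → (∀ t → n < t → h t ≡ 0) → CountsBounded n h →
                     ∀ t → sumFrom h (suc t) (suc (suc n) ∸ suc t) ≤ n ∸ suc t
tails-from-bounded n h vanish bounded t with suc t ≤? n
... | yes t+1≤n = begin
    sumFrom h (suc t) (suc (suc n) ∸ suc t)
  ≡⟨ cong (sumFrom h (suc t)) (trans (cong (λ m → suc (suc m) ∸ suc t) (sym eq)) (tails-beyond t g)) ⟩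
    sumFrom h (suc t) (suc g + 1)
  ≡⟨ sumFrom-split h (suc t) (suc g) 1 ⟩
    sumFrom h (suc t) (suc g) + (h (suc t + suc g) + 0)
  ≡⟨ cong (λ x → sumFrom h (suc t) (suc g) + (x + 0)) (vanish (suc t + suc g) n<) ⟩
    sumFrom h (suc t) (suc g) + 0
  ≡⟨ +-identityʳ _ ⟩
    sumFrom h (suc t) (suc g)
  ≤⟨ bounded g t eq ⟩
    g ∎
  where
  open ≤-Reasoning
  g : ℕ
  g = n ∸ suc t
  eq : suc t + g ≡ n
  eq = m+[n∸m]≡n t+1≤n
  n< : n < suc t + suc g
  n< = ≤-trans (≤-reflexive (cong suc (sym eq))) (≤-reflexive (sym (+-suc (suc t) g)))
... | no t+1≰n = ≤-trans (≤-reflexive (sumFrom-vanishing h (suc t) (suc (suc n) ∸ suc t) beyond-n)) z≤n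
  where
  beyond-n : ∀ x → suc t ≤ x → h x ≡ 0
  beyond-n x t<x = vanish x (<-≤-trans (≰⇒> t+1≰n) t<x)

-- Such counts yield a Young diagram in 𝕐_n: the entries ≥ s number at most n - s,
-- so the k-th entry is at most n - k - 1.
counts-in-Y : ∀ n h → (∀ t → n < t → h t ≡ 0) → CountsBounded n h → InY n (nth (blocks (suc (suc n)) h))
counts-in-Y n h vanish bounded =
  ((decreasing-nth (blocks-decreasing N h) , length diagram , λ k → nth-beyond diagram k) ,
   (λ k _ → entry-bound k) ,
   (λ k n≤k+1 → n≤0⇒n≡0 (subst (nth diagram k ≤_) (m≤n⇒m∸n≡0 n≤k+1) (entry-bound k))))
  where
  N : ℕ
  N = suc (suc n)
  diagram : List ℕ
  diagram = blocks N h
  entry-bound : ∀ k → nth diagram k ≤ n ∸ suc k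
  entry-bound k with nth diagram k in eq
  ... | zero = z≤n
  ... | suc s = swap-∸ n (suc s) k (begin
      suc k
    ≤⟨ countAtLeast-above-nth (blocks-decreasing N h) (suc s) k (s≤s z≤n) (≤-reflexive (sym eq)) ⟩
      countAtLeast (suc s) diagram
    ≡⟨ countAtLeast-blocks N h (suc s) ⟩
      sumFrom h (suc s) (N ∸ suc s)
    ≤⟨ tails-from-bounded n h vanish bounded s ⟩
      n ∸ suc s ∎)
    where open ≤-Reasoning

prefix : (ℕ → ℕ) → ℕ → List ℕ
prefix d zero = []
prefix d (suc m) = d 0 ∷ prefix (d ∘ suc) m

nth-prefix : ∀ d m k → k < m → nth (prefix d m) k ≡ d k
nth-prefix d (suc m) zero _ = refl
nth-prefix d (suc m) (suc k) (s≤s k<m) = nth-prefix (d ∘ suc) m k k<m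

nth-prefix-beyond : ∀ d m k → m ≤ k → nth (prefix d m) k ≡ 0
nth-prefix-beyond d zero k _ = refl
nth-prefix-beyond d (suc m) (suc k) (s≤s m≤k) = nth-prefix-beyond (d ∘ suc) m k m≤k

prefix-decreasing : ∀ d m → (∀ k → d (suc k) ≤ d k) → Decreasing (prefix d m)
prefix-decreasing d zero _ = []
prefix-decreasing d (suc zero) _ = [-]
prefix-decreasing d (suc (suc m)) decreasing = decreasing 0 ∷ prefix-decreasing (d ∘ suc) (suc m) (λ k → decreasing (suc k))

prefix-bounded : ∀ d m b → (∀ k → d k < b) → All (_< b) (prefix d m)
prefix-bounded d zero b _ = []
prefix-bounded d (suc m) b bound = bound 0 ∷ prefix-bounded (d ∘ suc) m b (λ k → bound (suc k))

module Diagram (n : ℕ) (n≥1 : 1 ≤ n) (d : Sequence) (d∈Y : InY n d) where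

  N : ℕ
  N = suc (suc n)

  decreasing : ∀ k → d (suc k) ≤ d k
  decreasing = proj₁ (proj₁ d∈Y)

  below-staircase : ∀ k → suc k ≤ n ∸ 1 → d k ≤ n ∸ suc k
  below-staircase = proj₁ (proj₂ d∈Y)

  vanishing : ∀ k → n ≤ suc k → d k ≡ 0
  vanishing = proj₂ (proj₂ d∈Y)

  entry-bound : ∀ k → d k ≤ n ∸ suc k
  entry-bound k with suc k ≤? n ∸ 1
  ... | yes k+1≤ = below-staircase k k+1≤
  ... | no k+1≰ = ≤-trans (≤-reflexive (vanishing k (≤-trans (m≤n+m∸n n 1) (≰⇒> k+1≰)))) z≤n

  entries : List ℕ
  entries = prefix d (n ∸ 1)

  counts : ℕ → ℕ
  counts t = multiplicity t entries

  nth-entries : ∀ k → nth entries k ≡ d k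
  nth-entries k with k <? n ∸ 1
  ... | yes k<m = nth-prefix d (n ∸ 1) k k<m
  ... | no k≮m = trans (nth-prefix-beyond d (n ∸ 1) k (≮⇒≥ k≮m))
                       (sym (vanishing k (≤-trans (m≤n+m∸n n 1) (s≤s (≮⇒≥ k≮m)))))

  entries-decreasing : Decreasing entries
  entries-decreasing = prefix-decreasing d (n ∸ 1) decreasing

  entries-bounded : All (_< n) entries
  entries-bounded = prefix-bounded d (n ∸ 1) n (λ k → ≤-<-trans (entry-bound k) (below n n≥1 k))
    where
    below : ∀ n → 1 ≤ n → ∀ k → n ∸ suc k < n
    below (suc n′) _ k = s≤s (m∸n≤m n′ k)

  counts-vanish : ∀ t → n ≤ t → counts t ≡ 0
  counts-vanish t n≤t = multiplicity-absent t entries entries-bounded n≤t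

  entries-as-blocks : entries ≡ blocks N counts
  entries-as-blocks = decreasing-as-blocks N entries entries-decreasing
                        (All.map (λ x<n → <-trans x<n (<-trans (n<1+n n) (n<1+n (suc n)))) entries-bounded)

  diagram-from-counts : ∀ k → nth (blocks N counts) k ≡ d k
  diagram-from-counts k = trans (cong (λ xs → nth xs k) (sym entries-as-blocks)) (nth-entries k)

  counts-bounded : CountsBounded n counts
  counts-bounded g t eq = begin
      sumFrom counts (suc t) (suc g)
    ≤⟨ m≤m+n _ _ ⟩
      sumFrom counts (suc t) (suc g) + sumFrom counts (suc t + suc g) 1
    ≡⟨ sym (sumFrom-split counts (suc t) (suc g) 1) ⟩
      sumFrom counts (suc t) (suc g + 1)
    ≡⟨ cong (sumFrom counts (suc t)) (sym (trans (cong (λ m → suc (suc m) ∸ suc t) (sym eq)) (tails-beyond t g))) ⟩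
      sumFrom counts (suc t) (N ∸ suc t)
    ≡⟨ sym (countAtLeast-blocks N counts (suc t)) ⟩
      countAtLeast (suc t) (blocks N counts)
    ≡⟨ cong (countAtLeast (suc t)) (sym entries-as-blocks) ⟩
      countAtLeast (suc t) entries
    ≤⟨ few ⟩
      g ∎
    where
    open ≤-Reasoning
    few : countAtLeast (suc t) entries ≤ g
    few with countAtLeast (suc t) entries ≤? g
    ... | yes few = few
    ... | no many = ⊥-elim (<-irrefl refl (begin-strict
        t
      <⟨ nth-above-countAtLeast entries-decreasing (suc t) g (≰⇒> many) ⟩
        nth entries g
      ≡⟨ nth-entries g ⟩
        d g
      ≤⟨ entry-bound g ⟩
        n ∸ suc g
      ≡⟨ trans (cong (_∸ suc g) (sym eq)) (trans (cong (_∸ suc g) (sym (+-suc t g))) (m+n∸n≡m t (suc g))) ⟩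
        t ∎))

Λ-in-Y : ∀ n (A : DiagSet n) → IsTriangulation n A → InY n (Λ A)
Λ-in-Y n A T = InY-cong (λ k → sym (Λ-as-blocks A k)) (counts-in-Y n (length ∘ rows A) vanish bounded)
  where
  open Rows n
  rows-A : RowTriangulation n (rows A)
  rows-A = triangulation⇒rows T
  vanish : ∀ t → n < t → length (rows A t) ≡ 0
  vanish t n<t = cong length (Rigidity.rows-vanish-beyond n (rows A) rows-A t n<t)
  bounded : CountsBounded n (length ∘ rows A)
  bounded = Visibility.fit⇒bounded n (length ∘ rows A) (Rigidity.rows-fit n (rows A) rows-A)

-- (ii) Λ is injective on triangulations: it records the row sizes t ≥ 1.
Λ-injective : ∀ n (A B : DiagSet n) → IsTriangulation n A → IsTriangulation n B →
              (∀ k → Λ A k ≡ Λ B k) → A ≡ B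
Λ-injective n A B TA TB same = rows-injective A B (determined-by-counts rows-A rows-B counts)
  where
  open Rows n
  rows-A : RowTriangulation n (rows A)
  rows-A = triangulation⇒rows TA
  rows-B : RowTriangulation n (rows B)
  rows-B = triangulation⇒rows TB
  counts : ∀ t → length (rows A (suc t)) ≡ length (rows B (suc t))
  counts t with suc t <? N
  ... | yes t+1<N = begin
      length (rows A (suc t))
    ≡⟨ sym (multiplicity-blocks N (length ∘ rows A) (suc t) t+1<N) ⟩
      multiplicity (suc t) (blocks N (length ∘ rows A))
    ≡⟨ multiplicity-determined t (blocks N (length ∘ rows A)) (blocks N (length ∘ rows B))
         (λ k → trans (sym (Λ-as-blocks A k)) (trans (same k) (Λ-as-blocks B k))) ⟩
      multiplicity (suc t) (blocks N (length ∘ rows B))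
    ≡⟨ multiplicity-blocks N (length ∘ rows B) (suc t) t+1<N ⟩
      length (rows B (suc t)) ∎
    where open ≡-Reasoning
  ... | no t+1≮N = trans (cong length (Rigidity.rows-vanish-beyond n (rows A) rows-A (suc t) n<t+1))
                         (sym (cong length (Rigidity.rows-vanish-beyond n (rows B) rows-B (suc t) n<t+1)))
    where
    n<t+1 : n < suc t
    n<t+1 = ≤-trans (n≤1+n (suc n)) (≮⇒≥ t+1≮N)

-- (iii) Every d ∈ 𝕐_n is Λ of the canonical triangulation for its multiplicities.
Λ-surjective : ∀ n → 1 ≤ n → (d : Sequence) → InY n d →
               Σ (DiagSet n) λ A → IsTriangulation n A × (∀ k → Λ A k ≡ d k)
Λ-surjective n n≥1 d d∈Y = M , rows⇒triangulation rows-M (canonical-triangulation n≥1) , Λ-M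
  where
  open Diagram n n≥1 d d∈Y
  open Visibility n counts
  open Canonical n counts
  open Rows n using (rows; matrix; rows-matrix; rows⇒triangulation; Λ-as-blocks)
  M : DiagSet n
  M = matrix canonicalRow
  rows-M : ∀ t → rows M t ≡ canonicalRow t
  rows-M = rows-matrix canonicalRow (canonical-triangulation n≥1)
  row-sizes : ∀ t → length (rows M (suc t)) ≡ counts (suc t)
  row-sizes t with suc t ≤? n
  ... | yes t+1≤n = trans (cong length (rows-M (suc t))) (canonical-row-length counts-bounded t t+1≤n)
  ... | no t+1≰n = trans (cong length (trans (rows-M (suc t)) (canonical-vanish-beyond t (≰⇒> t+1≰n))))
                         (sym (counts-vanish (suc t) (<⇒≤ (≰⇒> t+1≰n))))
  Λ-M : ∀ k → Λ M k ≡ d k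
  Λ-M k = trans (Λ-as-blocks M k)
                (trans (nth-blocks-positive (suc n) (length ∘ rows M) counts row-sizes k) (diagram-from-counts k))

proposition1 : ∀ (n : ℕ) → 1 ≤ n →
    ((A : DiagSet n) → IsTriangulation n A → InY n (Λ A))
    × ((A B : DiagSet n) → IsTriangulation n A → IsTriangulation n B →
         (∀ k → Λ A k ≡ Λ B k) → A ≡ B)
    × ((d : Sequence) → InY n d →
         Σ (DiagSet n) λ A → IsTriangulation n A × (∀ k → Λ A k ≡ d k))
proposition1 n n≥1 = Λ-in-Y n , Λ-injective n , Λ-surjective n n≥1
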